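{- Let $n=p^{m_1}q^{m_2}$, where $p<q$ are distinct primes and $m_1,m_2$ are positive integers. Then the hyper-Wiener index of the essential ideal graph $\mathcal{E}_{\mathbb{Z}_n}$ is $$WW(\mathcal{E}_{\mathbb{Z}_n})=\tfrac12\big[m_1m_2(m_1m_2-1)+(m_1+m_2)(2m_1m_2-5)+3(m_1^2+m_2^2)+2\big].$$
   Context: $\mathbb{Z}_n$ is the ring of integers modulo $n$. An ideal $I$ of a commutative ring $R$ is essential if $I\cap J\neq\{0\}$ for every nonzero ideal $J$ of $R$. The essential ideal graph $\mathcal{E}_{\mathbb{Z}_n}$ is the simple graph whose vertex set is the set of all nonzero proper ideals of $\mathbb{Z}_n$, two distinct vertices $I,K$ being adjacent if and only if $I+K$ is an essential ideal of $\mathbb{Z}_n$. For a connected graph $G$ with distance $d$, the Wiener index is $W(G)=\sum_{\{u,v\}} d(u,v)$ and the hyper-Wiener index is $WW(G)=\frac12 W(G)+\frac12\sum_{\{u,v\}} d(u,v)^2$, both sums over unordered pairs of distinct vertices. -}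

module Defs where

open import Data.Bool using (Bool; true; false; _∧_; _∨_; not; if_then_else_; T)
open import Data.Nat using (ℕ; zero; suc; _+_; _*_; _∸_; _<ᵇ_)
open import Data.Nat.DivMod using (_mod_)
open import Data.Fin using (Fin; toℕ) renaming (zero to fzero)
open import Data.Fin.Properties using (_≟_)
open import Data.Vec using (Vec; []; _∷_; lookup; tabulate)
open import Data.List using (List; []; _∷_; [_]; length; concatMap; filterᵇ; allFin; map)
open import Data.Bool.ListAction using (all; any)
open import Data.Nat.ListAction using (sum)
import Data.List as L
open import Data.Product using (∃)
open import Data.Integer using (ℤ; +_)
open import Data.Rational using (ℚ; ½; _/_) renaming (_+_ to _+ℚ_; _*_ to _*ℚ_)
open import Relation.Nullary using (does)

_⇒ᵇ_ : Bool → Bool → Bool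
a ⇒ᵇ b = not a ∨ b

allF : ∀ {m} → (Fin m → Bool) → Bool
allF {m} p = all p (allFin m)

anyF : ∀ {m} → (Fin m → Bool) → Bool
anyF {m} p = any p (allFin m)

_==_ : ∀ {m} → Fin m → Fin m → Bool
a == b = does (a ≟ b)

module Zn (k : ℕ) where
  N : ℕ
  N = suc k

  0ₙ : Fin N
  0ₙ = fzero

  _+ₙ_ : Fin N → Fin N → Fin N
  a +ₙ b = (toℕ a + toℕ b) mod N

  _*ₙ_ : Fin N → Fin N → Fin N
  a *ₙ b = (toℕ a * toℕ b) mod N

  -ₙ_ : Fin N → Fin N
  -ₙ a = (N ∸ toℕ a) mod N

  SubsetN : Set
  SubsetN = Vec Bool N

  _∈ᵇ_ : Fin N → SubsetN → Bool
  a ∈ᵇ I = lookup I a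

  isIdeal : SubsetN → Bool
  isIdeal I =
    (0ₙ ∈ᵇ I)
    ∧ allF (λ a → allF (λ b → ((a ∈ᵇ I) ∧ (b ∈ᵇ I)) ⇒ᵇ ((a +ₙ b) ∈ᵇ I)))
    ∧ allF (λ a → (a ∈ᵇ I) ⇒ᵇ ((-ₙ a) ∈ᵇ I))
    ∧ allF (λ r → allF (λ a → (a ∈ᵇ I) ⇒ᵇ ((r *ₙ a) ∈ᵇ I)))

  isNonzero : SubsetN → Bool
  isNonzero I = anyF (λ a → (a ∈ᵇ I) ∧ not (a == 0ₙ))

  isProper : SubsetN → Bool
  isProper I = anyF (λ a → not (a ∈ᵇ I))

  _⊕_ : SubsetN → SubsetN → SubsetN
  I ⊕ K = tabulate (λ x → anyF (λ i → anyF (λ j → (i ∈ᵇ I) ∧ (j ∈ᵇ K) ∧ ((i +ₙ j) == x))))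

  _∩ₙ_ : SubsetN → SubsetN → SubsetN
  I ∩ₙ J = tabulate (λ x → (x ∈ᵇ I) ∧ (x ∈ᵇ J))

  subsets : ∀ m → List (Vec Bool m)
  subsets zero = [ [] ]
  subsets (suc m) = concatMap (λ s → (true ∷ s) ∷ (false ∷ s) ∷ []) (subsets m)

  allSubsets : List SubsetN
  allSubsets = subsets N

  isEssential : SubsetN → Bool
  isEssential I = all (λ J → (isIdeal J ∧ isNonzero J) ⇒ᵇ isNonzero (I ∩ₙ J)) allSubsets

  vertices : List SubsetN
  vertices = filterᵇ (λ I → isIdeal I ∧ isNonzero I ∧ isProper I) allSubsets

record FinGraph : Set where
  field
    size : ℕ
    adj  : Fin size → Fin size → Bool

module GraphTheory (G : FinGraph) where
  open FinGraph G

  reach : ℕ → Fin size → Vec Bool size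
  reach zero u = tabulate (λ v → v == u)
  reach (suc t) u = tabulate (λ v → lookup (reach t u) v ∨ anyF (λ w → lookup (reach t u) w ∧ adj w v))

  Connected : Set
  Connected = ∀ u v → ∃ λ t → T (lookup (reach t u) v)

  search : (ℕ → Bool) → ℕ → ℕ → ℕ
  search f t zero = t
  search f t (suc fuel) = if f t then t else search f (suc t) fuel

  -- graph distance d(u,v) (for connected graphs the least t with v ∈ reach t u, t < size)
  dist : Fin size → Fin size → ℕ
  dist u v = search (λ t → lookup (reach t u) v) 0 size

  pairSum : (ℕ → ℕ) → ℕ
  pairSum g = sum (map (λ i → sum (map (λ j → if toℕ i <ᵇ toℕ j then g (dist i j) else 0) (allFin size))) (allFin size))

  wiener : ℕ
  wiener = pairSum (λ d → d)

  hyperWiener : ℚ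
  hyperWiener = (½ *ℚ ((+ wiener) / 1)) +ℚ (½ *ℚ ((+ pairSum (λ d → d * d)) / 1))

essentialIdealGraph : ℕ → FinGraph
essentialIdealGraph k = record
  { size = length vertices
  ; adj  = λ i j → not (i == j) ∧ isEssential (L.lookup vertices i ⊕ L.lookup vertices j)
  }
  where open Zn k

module Submission where

-- Write N = p ^ a * q ^ b with a = m₁ and b = m₂.  Every ideal of ℤ_N is generated by its least positive element,
-- a divisor p ^ i * q ^ j of N, so the vertices correspond to the exponents (i , j) ≤ (a , b) other than (0 , 0) and
-- (a , b).  A sum of two such ideals is generated by the gcd, and p ^ i * q ^ j ℤ_N is essential exactly when i < a
-- and j < b, since otherwise it meets q ^ b ℤ_N or p ^ a ℤ_N in {0}.  So two vertices are adjacent unless both have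
-- i = a or both have j = b, and such a pair has q ^ b ℤ_N or p ^ a ℤ_N as a common neighbour: all distances are 1
-- or 2.  Among the n = a b + a + b - 1 vertices, the pairs at distance 2 are the b (b - 1) / 2 pairs with i = a and
-- the a (a - 1) / 2 pairs with j = b, so W + S = Σ (d + d²) = n (n - 1) + 2 a (a - 1) + 2 b (b - 1) and WW = (W + S) / 2.

open import Data.Nat using (ℕ; suc; _^_; _*_)
open import Data.Nat.Primality using (Prime)
open import Relation.Binary.PropositionalEquality using (_≡_; _≢_)
open import Defs using (FinGraph)

module Booleans where
  open import Data.Bool using (Bool; true; false; T; _∧_; _∨_; not; if_then_else_)
  open import Data.Nat using (ℕ)
  open import Data.Fin using (Fin)
  open import Data.Fin.Properties using () renaming (_≟_ to _≟ᶠ_)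
  open import Data.List using (allFin)
  open import Data.List.Membership.Propositional using (lose)
  open import Data.List.Membership.Propositional.Properties using (∈-allFin)
  import Data.List.Relation.Unary.All as All
  open import Data.List.Relation.Unary.All.Properties using (all⁺; all⁻)
  open import Data.List.Relation.Unary.Any using (satisfied)
  open import Data.List.Relation.Unary.Any.Properties using (any⁺; any⁻)
  open import Data.Product using (∃; _×_; _,_)
  open import Data.Sum using (_⊎_; inj₁; inj₂)
  open import Data.Empty using (⊥-elim)
  open import Relation.Nullary using (Dec; yes; no; does; ¬_)
  open import Relation.Binary.PropositionalEquality using (_≡_; refl)
  open import Defs using (allF; anyF; _⇒ᵇ_; _==_)

  bool-ext : ∀ {a b} → (T a → T b) → (T b → T a) → a ≡ b
  bool-ext {false} {false} _ _ = refl
  bool-ext {false} {true}  _ g = ⊥-elim (g _)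
  bool-ext {true}  {false} f _ = ⊥-elim (f _)
  bool-ext {true}  {true}  _ _ = refl

  module _ {m : ℕ} (p : Fin m → Bool) where

    allF⁺ : (∀ x → T (p x)) → T (allF p)
    allF⁺ h = all⁻ p {allFin m} (All.tabulate λ {x} _ → h x)

    allF⁻ : T (allF p) → ∀ x → T (p x)
    allF⁻ h x = All.lookup (all⁺ p (allFin m) h) (∈-allFin x)

    anyF⁺ : ∀ x → T (p x) → T (anyF p)
    anyF⁺ x px = any⁺ p (lose (∈-allFin x) px)

    anyF⁻ : T (anyF p) → ∃ λ x → T (p x)
    anyF⁻ h = satisfied (any⁻ p (allFin m) h)

  ⇒ᵇ⁺ : ∀ {a b} → (T a → T b) → T (a ⇒ᵇ b)
  ⇒ᵇ⁺ {false} _ = _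
  ⇒ᵇ⁺ {true}  f = f _

  ⇒ᵇ⁻ : ∀ {a b} → T (a ⇒ᵇ b) → T a → T b
  ⇒ᵇ⁻ {true} h _ = h

  ∧⁺ : ∀ {a b} → T a → T b → T (a ∧ b)
  ∧⁺ {true} _ tb = tb

  ∧⁻ : ∀ {a b} → T (a ∧ b) → T a × T b
  ∧⁻ {true} tb = _ , tb

  does⁺ : ∀ {a} {A : Set a} (a? : Dec A) → A → T (does a?)
  does⁺ (yes _) _ = _
  does⁺ (no ¬a) a = ¬a a

  does⁻ : ∀ {a} {A : Set a} (a? : Dec A) → T (does a?) → A
  does⁻ (yes a) _ = a

  ∨⁺ˡ : ∀ {a b} → T a → T (a ∨ b)
  ∨⁺ˡ {true} _ = _

  ∨⁺ʳ : ∀ {a b} → T b → T (a ∨ b)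
  ∨⁺ʳ {true}  _  = _
  ∨⁺ʳ {false} tb = tb

  ∨⁻ : ∀ {a b} → T (a ∨ b) → T a ⊎ T b
  ∨⁻ {true}  _  = inj₁ _
  ∨⁻ {false} tb = inj₂ tb

  if-T : ∀ {A : Set} {b} {x y : A} → T b → (if b then x else y) ≡ x
  if-T {b = true} _ = refl

  if-¬T : ∀ {A : Set} {b} {x y : A} → ¬ T b → (if b then x else y) ≡ y
  if-¬T {b = false} _ = refl
  if-¬T {b = true}  ¬b = ⊥-elim (¬b _)

  T-not⁺ : ∀ {a} → ¬ T a → T (not a)
  T-not⁺ {false} _ = _
  T-not⁺ {true}  ¬a = ¬a _

  T-not⁻ : ∀ {a} → T (not a) → ¬ T a
  T-not⁻ {false} _ ()

  module _ {m : ℕ} {x y : Fin m} where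

    ==⁺ : x ≡ y → T (x == y)
    ==⁺ = does⁺ (x ≟ᶠ y)

    ==⁻ : T (x == y) → x ≡ y
    ==⁻ = does⁻ (x ≟ᶠ y)

module NumberTheory where
  open import Data.Nat
  open import Data.Nat.Properties
  open import Data.Nat.Divisibility
  open import Data.Nat.Primality
  open import Data.Nat.Coprimality using (Coprime; coprime-divisor)
  open import Data.Product using (∃; ∃₂; _×_; _,_)
  open import Data.Sum using (_⊎_; inj₁; inj₂; [_,_]′)
  open import Data.Empty using (⊥-elim)
  open import Relation.Nullary using (yes; no; ¬_)
  open import Relation.Unary using (Decidable)
  open import Relation.Binary.PropositionalEquality

  module _ {P : ℕ → Set} (P? : Decidable P) where

    private
      least-below : ∀ n → (∃ λ m → m < n × P m × (∀ {j} → j < m → ¬ P j)) ⊎ (∀ {j} → j < n → ¬ P j)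
      least-below zero = inj₂ λ ()
      least-below (suc n) with least-below n
      ... | inj₁ (m , m<n , Pm , m-least) = inj₁ (m , m<n⇒m<1+n m<n , Pm , m-least)
      ... | inj₂ none-below with P? n
      ...   | yes Pn = inj₁ (n , ≤-refl , Pn , none-below)
      ...   | no ¬Pn = inj₂ λ j<1+n → [ none-below , (λ { refl → ¬Pn }) ]′ (m<1+n⇒m<n∨m≡n j<1+n)

    least : ∀ {n} → P n → ∃ λ m → m ≤ n × P m × (∀ {j} → j < m → ¬ P j)
    least {n} Pn with least-below n
    ... | inj₁ (m , m<n , Pm , m-least) = m , <⇒≤ m<n , Pm , m-least
    ... | inj₂ none-below              = n , ≤-refl , Pn , none-below

  prime≢1 : ∀ {p} → Prime p → p ≢ 1
  prime≢1 pp refl = ¬prime[1] pp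

  module _ {p q} (pp : Prime p) (pq : Prime q) (p≢q : p ≢ q) where

    p∣q^b*k⇒p∣k : ∀ b k → p ∣ q ^ b * k → p ∣ k
    p∣q^b*k⇒p∣k zero    k p∣k = subst (p ∣_) (+-identityʳ k) p∣k
    p∣q^b*k⇒p∣k (suc b) k p∣qq^bk
      with euclidsLemma q (q ^ b * k) pp (subst (p ∣_) (*-assoc q (q ^ b) k) p∣qq^bk)
    ... | inj₂ p∣q^bk = p∣q^b*k⇒p∣k b k p∣q^bk
    ... | inj₁ p∣q with prime⇒irreducible pq p∣q
    ...   | inj₁ p≡1 = ⊥-elim (prime≢1 pp p≡1)
    ...   | inj₂ p≡q = ⊥-elim (p≢q p≡q)

    p^a∣q^b*k⇒p^a∣k : ∀ a b k → p ^ a ∣ q ^ b * k → p ^ a ∣ k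
    p^a∣q^b*k⇒p^a∣k zero    b k _ = 1∣ k
    p^a∣q^b*k⇒p^a∣k (suc a) b k pp^a∣q^bk with p∣q^b*k⇒p∣k b k (∣-trans (m∣m*n (p ^ a)) pp^a∣q^bk)
    ... | divides-refl k′ = subst (_∣ k′ * p) (*-comm (p ^ a) p) (*-monoˡ-∣ p p^a∣k′)
      where
      instance _ = prime⇒nonZero pp
      p^a∣k′ : p ^ a ∣ k′
      p^a∣k′ = p^a∣q^b*k⇒p^a∣k a b k′ (*-cancelˡ-∣ p (subst (p * p ^ a ∣_)
        (trans (sym (*-assoc (q ^ b) k′ p)) (*-comm (q ^ b * k′) p)) pp^a∣q^bk))

    p^i∣p^i′*q^j⇒i≤i′ : ∀ i i′ j → p ^ i ∣ p ^ i′ * q ^ j → i ≤ i′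
    p^i∣p^i′*q^j⇒i≤i′ zero    i′       j _ = z≤n
    p^i∣p^i′*q^j⇒i≤i′ (suc i) zero     j pp^i∣q^j =
      ⊥-elim (prime≢1 pp (∣1⇒≡1 (p∣q^b*k⇒p∣k j 1 (subst (p ∣_) (sym (*-identityʳ (q ^ j)))
        (∣-trans (m∣m*n (p ^ i)) (subst (p * p ^ i ∣_) (+-identityʳ (q ^ j)) pp^i∣q^j))))))
    p^i∣p^i′*q^j⇒i≤i′ (suc i) (suc i′) j pp^i∣pp^i′q^j = s≤s (p^i∣p^i′*q^j⇒i≤i′ i i′ j
      (*-cancelˡ-∣ p (subst (p * p ^ i ∣_) (*-assoc p (p ^ i′) (q ^ j)) pp^i∣pp^i′q^j)))
      where instance _ = prime⇒nonZero pp

  ¬∣⇒coprime : ∀ {r d} → Prime r → ¬ (r ∣ d) → Coprime d r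
  ¬∣⇒coprime pr r∤d (i∣d , i∣r) with prime⇒irreducible pr i∣r
  ... | inj₁ i≡1 = i≡1
  ... | inj₂ refl = ⊥-elim (r∤d i∣d)

  ∣prime^*⇒split : ∀ {r} → Prime r → ∀ a M d → d ∣ r ^ a * M →
                   ∃₂ λ i d′ → i ≤ a × d ≡ r ^ i * d′ × d′ ∣ M
  ∣prime^*⇒split pr zero M d d∣M = 0 , d , z≤n , sym (+-identityʳ d) , subst (d ∣_) (+-identityʳ M) d∣M
  ∣prime^*⇒split {r} pr (suc a) M d d∣rr^aM with r ∣? d
  ... | no r∤d =
    let i , d′ , i≤a , d≡ , d′∣M = ∣prime^*⇒split pr a M d
          (coprime-divisor (¬∣⇒coprime pr r∤d) (subst (d ∣_) (*-assoc r (r ^ a) M) d∣rr^aM))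
    in i , d′ , m≤n⇒m≤1+n i≤a , d≡ , d′∣M
  ... | yes (divides-refl d₀) =
    let i , d′ , i≤a , d₀≡ , d′∣M = ∣prime^*⇒split pr a M d₀ (*-cancelʳ-∣ r
          (subst (d₀ * r ∣_) (trans (*-assoc r (r ^ a) M) (*-comm r (r ^ a * M))) d∣rr^aM))
    in suc i , d′ , s≤s i≤a , trans (*-comm d₀ r) (trans (cong (r *_) d₀≡) (sym (*-assoc r (r ^ i) d′))) , d′∣M
    where instance _ = prime⇒nonZero pr

  ∣p^a*q^b⇒≡p^i*q^j : ∀ {p q} → Prime p → Prime q → ∀ a b d → d ∣ p ^ a * q ^ b →
                      ∃₂ λ i j → i ≤ a × j ≤ b × d ≡ p ^ i * q ^ j
  ∣p^a*q^b⇒≡p^i*q^j {p} {q} pp pq a b d d∣p^aq^b =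
    let i , d′ , i≤a , d≡ , d′∣q^b = ∣prime^*⇒split pp a (q ^ b) d d∣p^aq^b
        j , d″ , j≤b , d′≡ , d″∣1 = ∣prime^*⇒split pq b 1 d′ (subst (d′ ∣_) (sym (*-identityʳ (q ^ b))) d′∣q^b)
    in i , j , i≤a , j≤b , trans d≡ (cong (p ^ i *_)
         (trans d′≡ (trans (cong (q ^ j *_) (∣1⇒≡1 d″∣1)) (*-identityʳ (q ^ j)))))

  ^-monoʳ-∣ : ∀ p {i i′} → i ≤ i′ → p ^ i ∣ p ^ i′
  ^-monoʳ-∣ p {i} {i′} i≤i′ = divides (p ^ (i′ ∸ i)) (begin
    p ^ i′                ≡⟨ cong (p ^_) (sym (m+[n∸m]≡n i≤i′)) ⟩
    p ^ (i + (i′ ∸ i))    ≡⟨ ^-distribˡ-+-* p i (i′ ∸ i) ⟩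
    p ^ i * p ^ (i′ ∸ i)  ≡⟨ *-comm (p ^ i) (p ^ (i′ ∸ i)) ⟩
    p ^ (i′ ∸ i) * p ^ i  ∎)
    where open ≡-Reasoning

  ∣n∣m⇒∣n∸m : ∀ {d m n} → m ≤ n → d ∣ n → d ∣ m → d ∣ n ∸ m
  ∣n∣m⇒∣n∸m {d} m≤n d∣n d∣m = ∣m+n∣m⇒∣n (subst (d ∣_) (sym (m+[n∸m]≡n m≤n)) d∣n) d∣m

  ∣suc⇒0< : ∀ {d n} → d ∣ suc n → 0 < d
  ∣suc⇒0< {zero}  d∣1+n with () ← 0∣⇒≡0 d∣1+n
  ∣suc⇒0< {suc d} _ = s≤s z≤n

module ListSums where
  open import Data.Bool using (if_then_else_)
  open import Data.Nat
  open import Data.Nat.Properties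
  open import Data.Nat.ListAction using (sum)
  open import Data.Nat.ListAction.Properties using (sum-++; sum-↭)
  open import Data.Nat.Tactic.RingSolver using (solve-∀)
  open import Data.Fin using (Fin; toℕ) renaming (zero to fzero; suc to fsuc)
  open import Data.Fin.Properties using (toℕ-injective)
  open import Data.List using (List; []; _∷_; map; length; _++_; lookup; allFin; cartesianProduct)
  open import Data.List.Properties using (map-++; map-∘; length-map; length-++)
  open import Data.List.Membership.Propositional using (_∈_)
  open import Data.List.Membership.Propositional.Properties using (∈-lookup)
  open import Data.List.Relation.Unary.Any using (here; there)
  import Data.List.Relation.Unary.All as All
  open import Data.List.Relation.Unary.AllPairs using (_∷_)
  open import Data.List.Relation.Unary.Unique.Propositional using (Unique)
  open import Data.List.Relation.Binary.Permutation.Propositional using (_↭_)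
  open import Data.List.Relation.Binary.Permutation.Propositional.Properties using (map⁺)
  open import Data.Product using (_,_)
  open import Data.Empty using (⊥-elim)
  open import Function using (_∘_)
  open import Relation.Binary.Definitions using (tri<; tri≈; tri>)
  open import Relation.Binary.PropositionalEquality
  open Booleans using (if-T; if-¬T)

  module _ {A : Set} where

    ∑ : List A → (A → ℕ) → ℕ
    ∑ xs f = sum (map f xs)

    infix 5 ∑
    syntax ∑ xs (λ x → e) = ∑[ x ∈ xs ] e

    ∑-cong : ∀ xs {f g : A → ℕ} → (∀ {x} → x ∈ xs → f x ≡ g x) → ∑ xs f ≡ ∑ xs g
    ∑-cong []       f≗g = refl
    ∑-cong (x ∷ xs) f≗g = cong₂ _+_ (f≗g (here refl)) (∑-cong xs (f≗g ∘ there))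

    ∑-++ : ∀ xs ys (f : A → ℕ) → ∑ (xs ++ ys) f ≡ ∑ xs f + ∑ ys f
    ∑-++ xs ys f = trans (cong sum (map-++ f xs ys)) (sum-++ (map f xs) (map f ys))

    ∑-↭ : ∀ {xs ys} (f : A → ℕ) → xs ↭ ys → ∑ xs f ≡ ∑ ys f
    ∑-↭ f xs↭ys = sum-↭ (map⁺ f xs↭ys)

    ∑-+ : ∀ xs (f g : A → ℕ) → ∑[ x ∈ xs ] (f x + g x) ≡ ∑ xs f + ∑ xs g
    ∑-+ []       f g = refl
    ∑-+ (x ∷ xs) f g = trans (cong (f x + g x +_) (∑-+ xs f g)) (+-+-swap (f x) (g x) (∑ xs f) (∑ xs g))
      where
      +-+-swap : ∀ a b c d → a + b + (c + d) ≡ a + c + (b + d)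
      +-+-swap = solve-∀

    ∑-const : ∀ xs {f : A → ℕ} c → (∀ {x} → x ∈ xs → f x ≡ c) → ∑ xs f ≡ length xs * c
    ∑-const []       c f≡c = refl
    ∑-const (x ∷ xs) c f≡c = cong₂ _+_ (f≡c (here refl)) (∑-const xs c (f≡c ∘ there))

    ∑-off-diagonal : ∀ {xs} {f : A → ℕ} {u} c → Unique xs → u ∈ xs → f u ≡ 0 →
                     (∀ {v} → v ∈ xs → u ≢ v → f v ≡ c) → ∑ xs f + c ≡ length xs * c
    ∑-off-diagonal {x ∷ xs} {f} c (x∉xs ∷ _) (here refl) fu≡0 f≡c = begin
      f x + ∑ xs f + c       ≡⟨ cong (λ y → y + ∑ xs f + c) fu≡0 ⟩
      ∑ xs f + c             ≡⟨ cong (_+ c) (∑-const xs c λ v∈ → f≡c (there v∈) (All.lookup x∉xs v∈)) ⟩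
      length xs * c + c      ≡⟨ +-comm (length xs * c) c ⟩
      c + length xs * c      ∎
      where open ≡-Reasoning
    ∑-off-diagonal {x ∷ xs} {f} c (x∉xs ∷ xs-unique) (there u∈) fu≡0 f≡c = begin
      f x + ∑ xs f + c       ≡⟨ +-assoc (f x) (∑ xs f) c ⟩
      f x + (∑ xs f + c)     ≡⟨ cong₂ _+_ (f≡c (here refl) (λ { refl → All.lookup x∉xs u∈ refl }))
                                           (∑-off-diagonal c xs-unique u∈ fu≡0 (f≡c ∘ there)) ⟩
      c + length xs * c      ∎
      where open ≡-Reasoning

    ∑-shift : ∀ xs {g : A → ℕ} c d → (∀ {x} → x ∈ xs → g x + c ≡ d) → ∑ xs g + length xs * c ≡ length xs * d
    ∑-shift []       c d g+c≡d = refl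
    ∑-shift (x ∷ xs) {g} c d g+c≡d = begin
      g x + ∑ xs g + (c + length xs * c)    ≡⟨ +-+-swap (g x) (∑ xs g) c (length xs * c) ⟩
      (g x + c) + (∑ xs g + length xs * c)  ≡⟨ cong₂ _+_ (g+c≡d (here refl)) (∑-shift xs c d (g+c≡d ∘ there)) ⟩
      d + length xs * d                     ∎
      where
      open ≡-Reasoning
      +-+-swap : ∀ a b c d → a + b + (c + d) ≡ a + c + (b + d)
      +-+-swap = solve-∀

    ∑∑-off-diagonal : ∀ {xs} {f : A → A → ℕ} c → Unique xs → (∀ {u} → u ∈ xs → f u u ≡ 0) →
                      (∀ {u v} → u ∈ xs → v ∈ xs → u ≢ v → f u v ≡ c) →
                      (∑[ u ∈ xs ] ∑ xs (f u)) + length xs * c ≡ length xs * (length xs * c)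
    ∑∑-off-diagonal {xs} c xs-unique diagonal off-diagonal = ∑-shift xs c (length xs * c) λ u∈ →
      ∑-off-diagonal c xs-unique u∈ (diagonal u∈) (off-diagonal u∈)

    ∑∑-const : ∀ xs ys {f : A → A → ℕ} c → (∀ {u v} → u ∈ xs → v ∈ ys → f u v ≡ c) →
               ∑[ u ∈ xs ] ∑ ys (f u) ≡ length xs * (length ys * c)
    ∑∑-const xs ys c f≡c = ∑-const xs (length ys * c) λ u∈ → ∑-const ys c (f≡c u∈)

  module _ {A B : Set} where

    ∑-map : ∀ (g : A → B) xs (f : B → ℕ) → ∑ (map g xs) f ≡ ∑ xs (f ∘ g)
    ∑-map g xs f = cong sum (sym (map-∘ xs))

    ∑-comm : ∀ xs ys (f : A → B → ℕ) → ∑[ x ∈ xs ] ∑[ y ∈ ys ] f x y ≡ ∑[ y ∈ ys ] ∑[ x ∈ xs ] f x y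
    ∑-comm []       ys f = sym (trans (∑-const ys 0 λ _ → refl) (*-zeroʳ (length ys)))
    ∑-comm (x ∷ xs) ys f = trans (cong (∑ ys (f x) +_) (∑-comm xs ys f))
      (sym (∑-+ ys (f x) (λ y → ∑[ x ∈ xs ] f x y)))

  length-cartesianProduct : ∀ {A B : Set} (xs : List A) (ys : List B) →
                            length (cartesianProduct xs ys) ≡ length xs * length ys
  length-cartesianProduct []       ys = refl
  length-cartesianProduct (x ∷ xs) ys = trans (length-++ (map (x ,_) ys))
    (cong₂ _+_ (length-map (x ,_) ys) (length-cartesianProduct xs ys))

  lookup-injective : ∀ {A : Set} {xs : List A} → Unique xs → ∀ i j → lookup xs i ≡ lookup xs j → i ≡ j
  lookup-injective {xs = x List.∷ xs} (x∉xs ∷ _) fzero    fzero    _ = refl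
  lookup-injective {xs = x List.∷ xs} (x∉xs ∷ _) fzero    (fsuc j) x≡ = ⊥-elim (All.lookup x∉xs (∈-lookup j) x≡)
  lookup-injective {xs = x List.∷ xs} (x∉xs ∷ _) (fsuc i) fzero    ≡x = ⊥-elim (All.lookup x∉xs (∈-lookup i) (sym ≡x))
  lookup-injective {xs = x List.∷ xs} (_ ∷ xs-unique) (fsuc i) (fsuc j) eq = cong fsuc (lookup-injective xs-unique i j eq)

  module _ {n : ℕ} (h : Fin n → Fin n → ℕ) where

    upper : Fin n → Fin n → ℕ
    upper i j = if toℕ i <ᵇ toℕ j then h i j else 0

    module _ (h-sym : ∀ i j → h i j ≡ h j i) (h-diag : ∀ i → h i i ≡ 0) where

      upper+lower : ∀ i j → h i j ≡ upper i j + upper j i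
      upper+lower i j with <-cmp (toℕ i) (toℕ j)
      ... | tri< i<j _ j≮i = sym (trans (cong₂ _+_ (if-T (<⇒<ᵇ i<j)) (if-¬T (j≮i ∘ <ᵇ⇒< _ _))) (+-identityʳ (h i j)))
      ... | tri> i≮j _ j<i = sym (trans (cong₂ _+_ (if-¬T (i≮j ∘ <ᵇ⇒< _ _)) (if-T (<⇒<ᵇ j<i))) (h-sym j i))
      ... | tri≈ i≮j i≡j _ with toℕ-injective i≡j
      ...   | refl = trans (h-diag i) (sym (cong₂ _+_ (if-¬T (i≮j ∘ <ᵇ⇒< _ _)) (if-¬T (i≮j ∘ <ᵇ⇒< _ _))))

      2*∑∑upper≡∑∑ : 2 * (∑[ i ∈ allFin n ] ∑[ j ∈ allFin n ] upper i j)
                   ≡ ∑[ i ∈ allFin n ] ∑[ j ∈ allFin n ] h i j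
      2*∑∑upper≡∑∑ = begin
        2 * U
          ≡⟨ cong (U +_) (+-identityʳ U) ⟩
        U + U
          ≡⟨ cong (U +_) (∑-comm (allFin n) (allFin n) upper) ⟩
        U + (∑[ i ∈ allFin n ] ∑[ j ∈ allFin n ] upper j i)
          ≡⟨ ∑-+ (allFin n) _ _ ⟨
        ∑[ i ∈ allFin n ] (∑ (allFin n) (upper i) + (∑[ j ∈ allFin n ] upper j i))
          ≡⟨ ∑-cong (allFin n) (λ {i} _ → sym (∑-+ (allFin n) (upper i) (λ j → upper j i))) ⟩
        ∑[ i ∈ allFin n ] ∑[ j ∈ allFin n ] (upper i j + upper j i)
          ≡⟨ ∑-cong (allFin n) (λ {i} _ → ∑-cong (allFin n) λ {j} _ → sym (upper+lower i j)) ⟩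
        ∑[ i ∈ allFin n ] ∑[ j ∈ allFin n ] h i j
          ∎
        where
        open ≡-Reasoning
        U : ℕ
        U = ∑[ i ∈ allFin n ] ∑[ j ∈ allFin n ] upper i j

module Ideals (k : ℕ) where
  open import Data.Bool using (Bool; true; false; T; not; _∧_)
  open import Data.Nat
  open import Data.Nat.Properties
  open import Data.Nat.DivMod
  open import Data.Nat.Divisibility
  open import Data.Nat.GCD using (gcd; gcd[m,n]∣m; gcd[m,n]∣n; gcd-GCD; module Bézout)
  open import Data.Fin using (Fin; toℕ) renaming (zero to fzero; suc to fsuc)
  open import Data.Fin.Properties using (toℕ-fromℕ<; toℕ-injective; toℕ<n)
  open import Data.Vec using (Vec; []; _∷_; lookup; tabulate)
  open import Data.Vec.Properties using (lookup∘tabulate; tabulate∘lookup; tabulate-cong)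
  open import Data.List using (List; concatMap)
  import Data.List as List
  open import Data.List.Membership.Propositional using (_∈_)
  open import Data.List.Membership.Propositional.Properties using (∈-++⁺ˡ; ∈-++⁺ʳ)
  open import Data.List.Relation.Unary.Any using (here; there)
  import Data.List.Relation.Unary.All as All
  import Data.List.Relation.Unary.All.Properties as All
  open import Data.List.Relation.Unary.AllPairs as AllPairs using ([]; _∷_)
  import Data.List.Relation.Unary.AllPairs.Properties as AllPairs
  open import Data.List.Relation.Unary.Unique.Propositional using (Unique)
  open import Data.List.Relation.Unary.Unique.Propositional.Properties using (concat⁺)
  open import Data.List.Relation.Binary.Disjoint.Propositional using (Disjoint)
  open import Data.Product using (∃; ∃₂; _×_; _,_; proj₁; proj₂)
  open import Data.Empty using (⊥-elim)
  open import Function using (_∘_)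
  open import Relation.Nullary using (no; does; ¬_)
  open import Relation.Nullary.Decidable using (T?; map′)
  open import Relation.Unary using (Decidable)
  open import Relation.Binary.PropositionalEquality
  open import Defs
  open Booleans
  open NumberTheory using (least; ∣n∣m⇒∣n∸m; ∣suc⇒0<)

  open Zn k

  toℕ-mod : ∀ m → toℕ (m mod N) ≡ m % N
  toℕ-mod m = toℕ-fromℕ< (m%n<n m N)

  toℕ-mod-< : ∀ {m} → m < N → toℕ (m mod N) ≡ m
  toℕ-mod-< {m} m<N = trans (toℕ-mod m) (m<n⇒m%n≡m m<N)

  mod-toℕ : ∀ x → toℕ x mod N ≡ x
  mod-toℕ x = toℕ-injective (toℕ-mod-< (toℕ<n x))

  mod-cong : ∀ m n → m % N ≡ n % N → m mod N ≡ n mod N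
  mod-cong m n eq = toℕ-injective (trans (toℕ-mod m) (trans eq (sym (toℕ-mod n))))

  subset-ext : ∀ {I J} → (∀ x → T (x ∈ᵇ I) → T (x ∈ᵇ J)) → (∀ x → T (x ∈ᵇ J) → T (x ∈ᵇ I)) → I ≡ J
  subset-ext {I} {J} I⊆J J⊆I = trans (sym (tabulate∘lookup I))
    (trans (tabulate-cong λ x → bool-ext (I⊆J x) (J⊆I x)) (tabulate∘lookup J))

  ⟨_⟩ : ℕ → SubsetN
  ⟨ c ⟩ = tabulate λ x → does (c ∣? toℕ x)

  module _ {c : ℕ} where

    ∈⟨⟩⁺ : ∀ x → c ∣ toℕ x → T (x ∈ᵇ ⟨ c ⟩)
    ∈⟨⟩⁺ x c∣x = subst T (sym (lookup∘tabulate (λ x → does (c ∣? toℕ x)) x)) (does⁺ (c ∣? toℕ x) c∣x)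

    ∈⟨⟩⁻ : ∀ x → T (x ∈ᵇ ⟨ c ⟩) → c ∣ toℕ x
    ∈⟨⟩⁻ x x∈ = does⁻ (c ∣? toℕ x) (subst T (lookup∘tabulate (λ x → does (c ∣? toℕ x)) x) x∈)

  ∣-mod : ∀ {d m} → d ∣ N → d ∣ m → d ∣ toℕ (m mod N)
  ∣-mod {d} {m} d∣N d∣m = subst (d ∣_) (sym (toℕ-mod m)) (%-presˡ-∣ d∣m d∣N)

  record IdealLaws (I : SubsetN) : Set where
    field
      0∈ : T (0ₙ ∈ᵇ I)
      +∈ : ∀ a b → T (a ∈ᵇ I) → T (b ∈ᵇ I) → T ((a +ₙ b) ∈ᵇ I)
      -∈ : ∀ a → T (a ∈ᵇ I) → T ((-ₙ a) ∈ᵇ I)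
      *∈ : ∀ r a → T (a ∈ᵇ I) → T ((r *ₙ a) ∈ᵇ I)

  module _ {I : SubsetN} where
    private
      +closed -closed : Fin N → Bool
      +closed a = allF λ b → ((a ∈ᵇ I) ∧ (b ∈ᵇ I)) ⇒ᵇ ((a +ₙ b) ∈ᵇ I)
      -closed a = (a ∈ᵇ I) ⇒ᵇ ((-ₙ a) ∈ᵇ I)
      *closed : Fin N → Bool
      *closed r = allF λ a → (a ∈ᵇ I) ⇒ᵇ ((r *ₙ a) ∈ᵇ I)

    isIdeal⁺ : IdealLaws I → T (isIdeal I)
    isIdeal⁺ laws = ∧⁺ {0ₙ ∈ᵇ I} 0∈ (∧⁺ {allF +closed} adds (∧⁺ {allF -closed} negations products))
      where
      open IdealLaws laws
      adds : T (allF +closed)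
      adds = allF⁺ +closed λ a → allF⁺ _ λ b → ⇒ᵇ⁺ {(a ∈ᵇ I) ∧ (b ∈ᵇ I)} λ a,b∈ →
               let a∈ , b∈ = ∧⁻ {a ∈ᵇ I} a,b∈ in +∈ a b a∈ b∈
      negations : T (allF -closed)
      negations = allF⁺ -closed λ a → ⇒ᵇ⁺ {a ∈ᵇ I} (-∈ a)
      products : T (allF *closed)
      products = allF⁺ *closed λ r → allF⁺ _ λ a → ⇒ᵇ⁺ {a ∈ᵇ I} (*∈ r a)

    isIdeal⁻ : T (isIdeal I) → IdealLaws I
    isIdeal⁻ I-ideal = record
      { 0∈ = 0∈
      ; +∈ = λ a b a∈ b∈ →
          ⇒ᵇ⁻ {(a ∈ᵇ I) ∧ (b ∈ᵇ I)} (allF⁻ _ (allF⁻ +closed +∈ a) b) (∧⁺ {a ∈ᵇ I} a∈ b∈)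
      ; -∈ = λ a → ⇒ᵇ⁻ {a ∈ᵇ I} (allF⁻ -closed -∈ a)
      ; *∈ = λ r a → ⇒ᵇ⁻ {a ∈ᵇ I} (allF⁻ _ (allF⁻ *closed *∈ r) a)
      }
      where
      0∈ : T (0ₙ ∈ᵇ I)
      0∈ = proj₁ (∧⁻ {0ₙ ∈ᵇ I} I-ideal)
      closures : T (allF +closed) × T (allF -closed ∧ allF *closed)
      closures = ∧⁻ {allF +closed} (proj₂ (∧⁻ {0ₙ ∈ᵇ I} I-ideal))
      +∈ : T (allF +closed)
      +∈ = proj₁ closures
      -∈ : T (allF -closed)
      -∈ = proj₁ (∧⁻ {allF -closed} (proj₂ closures))
      *∈ : T (allF *closed)
      *∈ = proj₂ (∧⁻ {allF -closed} (proj₂ closures))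

  ⟨⟩-isIdeal : ∀ {c} → c ∣ N → T (isIdeal ⟨ c ⟩)
  ⟨⟩-isIdeal {c} c∣N = isIdeal⁺ {⟨ c ⟩} record
    { 0∈ = ∈⟨⟩⁺ 0ₙ (c ∣0)
    ; +∈ = λ a b a∈ b∈ → ∈⟨⟩⁺ (a +ₙ b) (∣-mod c∣N (∣m∣n⇒∣m+n (∈⟨⟩⁻ a a∈) (∈⟨⟩⁻ b b∈)))
    ; -∈ = λ a a∈ → ∈⟨⟩⁺ (-ₙ a) (∣-mod c∣N (∣n∣m⇒∣n∸m (<⇒≤ (toℕ<n a)) c∣N (∈⟨⟩⁻ a a∈)))
    ; *∈ = λ r a a∈ → ∈⟨⟩⁺ (r *ₙ a) (∣-mod c∣N (∣n⇒∣m*n (toℕ r) (∈⟨⟩⁻ a a∈)))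
    }

  -- Residues are read modulo N, so N itself counts as an element: the least positive element exists even for I = {0}.
  module Generator {I : SubsetN} (laws : IdealLaws I) where
    open IdealLaws laws

    Contains : ℕ → Set
    Contains n = T ((n mod N) ∈ᵇ I)

    contains-toℕ : ∀ x → T (x ∈ᵇ I) → Contains (toℕ x)
    contains-toℕ x = subst (λ y → T (y ∈ᵇ I)) (sym (mod-toℕ x))

    toℕ-contains : ∀ x → Contains (toℕ x) → T (x ∈ᵇ I)
    toℕ-contains x = subst (λ y → T (y ∈ᵇ I)) (mod-toℕ x)

    contains-resp : ∀ m n → m % N ≡ n % N → Contains m → Contains n
    contains-resp m n eq = subst (λ y → T (y ∈ᵇ I)) (mod-cong m n eq)

    contains-N : Contains N
    contains-N = contains-resp 0 N (sym (n%n≡0 N)) (subst (λ y → T (y ∈ᵇ I)) (sym (mod-toℕ 0ₙ)) 0∈)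

    contains-+ : ∀ m n → Contains m → Contains n → Contains (m + n)
    contains-+ m n m∈ n∈ = contains-resp (toℕ (m mod N) + toℕ (n mod N)) (m + n)
      (trans (cong (_% N) (cong₂ _+_ (toℕ-mod m) (toℕ-mod n))) (sym (%-distribˡ-+ m n N)))
      (+∈ (m mod N) (n mod N) m∈ n∈)

    contains-* : ∀ t n → Contains n → Contains (t * n)
    contains-* t n n∈ = contains-resp (toℕ (t mod N) * toℕ (n mod N)) (t * n)
      (trans (cong (_% N) (cong₂ _*_ (toℕ-mod t) (toℕ-mod n))) (sym (%-distribˡ-* t n N)))
      (*∈ (t mod N) (n mod N) n∈)

    PositiveElement : ℕ → Set
    PositiveElement n = 0 < n × Contains n

    positiveElement? : Decidable PositiveElement
    positiveElement? zero    = no λ ()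
    positiveElement? (suc n) = map′ (s≤s z≤n ,_) proj₂ (T? ((suc n mod N) ∈ᵇ I))

    private
      minimal : ∃ λ m → m ≤ N × PositiveElement m × (∀ {j} → j < m → ¬ PositiveElement j)
      minimal = least positiveElement? (s≤s z≤n , contains-N)

    generator : ℕ
    generator = proj₁ minimal

    generator-positive : 0 < generator
    generator-positive = proj₁ (proj₁ (proj₂ (proj₂ minimal)))

    generator-contained : Contains generator
    generator-contained = proj₂ (proj₁ (proj₂ (proj₂ minimal)))

    instance
      generator≢0 : NonZero generator
      generator≢0 = >-nonZero generator-positive

    generator-divides : ∀ n → Contains n → generator ∣ n
    generator-divides n n∈ = m%n≡0⇒n∣m n generator remainder≡0
      where
      g q : ℕ
      g = generator
      q = n / g
      n+kqg≡r+qgN : n + k * (q * g) ≡ n % g + q * g * N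
      n+kqg≡r+qgN = begin
        n + k * (q * g)                ≡⟨ cong (_+ k * (q * g)) (m≡m%n+[m/n]*n n g) ⟩
        n % g + q * g + k * (q * g)    ≡⟨ +-assoc (n % g) (q * g) (k * (q * g)) ⟩
        n % g + (q * g + k * (q * g))  ≡⟨ cong (n % g +_) (*-comm N (q * g)) ⟩
        n % g + q * g * N              ∎
        where open ≡-Reasoning
      remainder-contained : Contains (n % g)
      remainder-contained = contains-resp (n % g + q * g * N) (n % g) ([m+kn]%n≡m%n (n % g) (q * g) N)
        (subst Contains n+kqg≡r+qgN (contains-+ n (k * (q * g)) n∈ (contains-* k (q * g) (contains-* q g generator-contained))))
      remainder≡0 : n % g ≡ 0
      remainder≡0 with n % g in r≡
      ... | zero  = refl
      ... | suc r = ⊥-elim (proj₂ (proj₂ (proj₂ minimal)) (subst (_< g) r≡ (m%n<n n g))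
                                  (s≤s z≤n , subst Contains r≡ remainder-contained))

    generator∣N : generator ∣ N
    generator∣N = generator-divides N contains-N

    ≡⟨generator⟩ : I ≡ ⟨ generator ⟩
    ≡⟨generator⟩ = subset-ext
      (λ x x∈ → ∈⟨⟩⁺ x (generator-divides (toℕ x) (contains-toℕ x x∈)))
      (λ x x∈ → toℕ-contains x (generated (∈⟨⟩⁻ x x∈)))
      where
      generated : ∀ {n} → generator ∣ n → Contains n
      generated (divides-refl t) = contains-* t generator generator-contained

  isIdeal⇒≡⟨⟩ : ∀ {I} → T (isIdeal I) → ∃ λ c → c ∣ N × I ≡ ⟨ c ⟩
  isIdeal⇒≡⟨⟩ {I} I-ideal = generator , generator∣N , ≡⟨generator⟩
    where open Generator (isIdeal⁻ {I} I-ideal)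

  module _ {I K : SubsetN} where
    private
      splits : Fin N → Fin N → Fin N → Bool
      splits x i j = (i ∈ᵇ I) ∧ (j ∈ᵇ K) ∧ ((i +ₙ j) == x)

      lookup-⊕ : ∀ x → x ∈ᵇ (I ⊕ K) ≡ anyF (λ i → anyF (splits x i))
      lookup-⊕ x = lookup∘tabulate (λ x → anyF (λ i → anyF (splits x i))) x

    ∈⊕⁺ : ∀ x i j → T (i ∈ᵇ I) → T (j ∈ᵇ K) → i +ₙ j ≡ x → T (x ∈ᵇ (I ⊕ K))
    ∈⊕⁺ x i j i∈ j∈ i+j≡x = subst T (sym (lookup-⊕ x))
      (anyF⁺ _ i (anyF⁺ (splits x i) j (∧⁺ {i ∈ᵇ I} i∈ (∧⁺ {j ∈ᵇ K} j∈ (==⁺ i+j≡x)))))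

    ∈⊕⁻ : ∀ x → T (x ∈ᵇ (I ⊕ K)) → ∃₂ λ i j → T (i ∈ᵇ I) × T (j ∈ᵇ K) × i +ₙ j ≡ x
    ∈⊕⁻ x x∈ =
      let i , ∃j = anyF⁻ _ (subst T (lookup-⊕ x) x∈)
          j , i,j,sum = anyF⁻ (splits x i) ∃j
          i∈ , j,sum = ∧⁻ {i ∈ᵇ I} i,j,sum
          j∈ , sum = ∧⁻ {j ∈ᵇ K} j,sum
      in i , j , i∈ , j∈ , ==⁻ sum

  module _ {c e : ℕ} (c∣N : c ∣ N) (e∣N : e ∣ N) where

    ∈⟨⟩⊕⟨⟩⁺ : ∀ x m n → c ∣ m → e ∣ n → (m + n) % N ≡ toℕ x → T (x ∈ᵇ (⟨ c ⟩ ⊕ ⟨ e ⟩))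
    ∈⟨⟩⊕⟨⟩⁺ x m n c∣m e∣n m+n≡x =
      ∈⊕⁺ {⟨ c ⟩} {⟨ e ⟩} x (m mod N) (n mod N)
        (∈⟨⟩⁺ {c} _ (∣-mod c∣N c∣m)) (∈⟨⟩⁺ {e} _ (∣-mod e∣N e∣n)) (toℕ-injective (begin
        toℕ ((toℕ (m mod N) + toℕ (n mod N)) mod N) ≡⟨ toℕ-mod (toℕ (m mod N) + toℕ (n mod N)) ⟩
        (toℕ (m mod N) + toℕ (n mod N)) % N         ≡⟨ cong₂ (λ u v → (u + v) % N) (toℕ-mod m) (toℕ-mod n) ⟩
        (m % N + n % N) % N                         ≡⟨ %-distribˡ-+ m n N ⟨
        (m + n) % N                                 ≡⟨ m+n≡x ⟩
        toℕ x                                       ∎))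
      where open ≡-Reasoning

    -- -B is represented by B * k = B * (N - 1)
    [A+B*k]%N≡x%N : ∀ x A B → x + B ≡ A → (A + B * k) % N ≡ x % N
    [A+B*k]%N≡x%N x A B x+B≡A = begin
      (A + B * k) % N      ≡⟨ cong (λ y → (y + B * k) % N) x+B≡A ⟨
      (x + B + B * k) % N  ≡⟨ cong (_% N) (+-assoc x B (B * k)) ⟩
      (x + (B + B * k)) % N ≡⟨ cong (λ y → (x + y) % N) (*-suc B k) ⟨
      (x + B * N) % N      ≡⟨ [m+kn]%n≡m%n x B N ⟩
      x % N                ∎
      where open ≡-Reasoning

    ⟨⟩⊕⟨⟩≡⟨gcd⟩ : ⟨ c ⟩ ⊕ ⟨ e ⟩ ≡ ⟨ gcd c e ⟩
    ⟨⟩⊕⟨⟩≡⟨gcd⟩ = subset-ext ⊆ ⊇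
      where
      g : ℕ
      g = gcd c e
      g∣N : g ∣ N
      g∣N = ∣-trans (gcd[m,n]∣m c e) c∣N
      ⊆ : ∀ x → T (x ∈ᵇ (⟨ c ⟩ ⊕ ⟨ e ⟩)) → T (x ∈ᵇ ⟨ g ⟩)
      ⊆ x x∈ with ∈⊕⁻ {⟨ c ⟩} {⟨ e ⟩} x x∈
      ... | i , j , i∈ , j∈ , refl = ∈⟨⟩⁺ {g} (i +ₙ j) (∣-mod g∣N (∣m∣n⇒∣m+n
              (∣-trans (gcd[m,n]∣m c e) (∈⟨⟩⁻ i i∈)) (∣-trans (gcd[m,n]∣n c e) (∈⟨⟩⁻ j j∈))))
      x%N≡x : ∀ x → toℕ x % N ≡ toℕ x
      x%N≡x x = m<n⇒m%n≡m (toℕ<n x)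
      multiple : ∀ t u d → d ∣ t * (u * d)
      multiple t u d = ∣n⇒∣m*n t (n∣m*n u)
      scaled : ∀ {y t m n} → y ≡ t * g → g + m ≡ n → y + t * m ≡ t * n
      scaled {t = t} refl g+m≡n = trans (sym (*-distribˡ-+ t g _)) (cong (t *_) g+m≡n)
      ⊇ : ∀ x → T (x ∈ᵇ ⟨ g ⟩) → T (x ∈ᵇ (⟨ c ⟩ ⊕ ⟨ e ⟩))
      ⊇ x x∈ with ∈⟨⟩⁻ {g} x x∈ | Bézout.identity (gcd-GCD c e)
      ... | divides t x≡tg | Bézout.+- u v g+ve≡uc =
        ∈⟨⟩⊕⟨⟩⁺ x (t * (u * c)) (t * (v * e) * k) (multiple t u c) (∣-trans (multiple t v e) (m∣m*n k))
          (trans ([A+B*k]%N≡x%N (toℕ x) (t * (u * c)) (t * (v * e)) (scaled {t = t} x≡tg g+ve≡uc)) (x%N≡x x))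
      ... | divides t x≡tg | Bézout.-+ u v g+uc≡ve =
        ∈⟨⟩⊕⟨⟩⁺ x (t * (u * c) * k) (t * (v * e)) (∣-trans (multiple t u c) (m∣m*n k)) (multiple t v e)
          (trans (cong (_% N) (+-comm (t * (u * c) * k) (t * (v * e))))
            (trans ([A+B*k]%N≡x%N (toℕ x) (t * (v * e)) (t * (u * c)) (scaled {t = t} x≡tg g+uc≡ve)) (x%N≡x x)))

  module _ {I : SubsetN} where
    private
      nonzeroElement notElement : Fin N → Bool
      nonzeroElement x = (x ∈ᵇ I) ∧ not (x == 0ₙ)
      notElement x = not (x ∈ᵇ I)

    isNonzero⁺ : ∀ x → T (x ∈ᵇ I) → x ≢ 0ₙ → T (isNonzero I)
    isNonzero⁺ x x∈ x≢0 = anyF⁺ nonzeroElement x (∧⁺ {x ∈ᵇ I} x∈ (T-not⁺ (x≢0 ∘ ==⁻)))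

    isNonzero⁻ : T (isNonzero I) → ∃ λ x → T (x ∈ᵇ I) × x ≢ 0ₙ
    isNonzero⁻ nz = let x , x∈,x≢0 = anyF⁻ nonzeroElement nz
                        x∈ , x≢0 = ∧⁻ {x ∈ᵇ I} x∈,x≢0
                    in x , x∈ , T-not⁻ x≢0 ∘ ==⁺

    isProper⁺ : ∀ x → ¬ T (x ∈ᵇ I) → T (isProper I)
    isProper⁺ x x∉ = anyF⁺ notElement x (T-not⁺ x∉)

    isProper⁻ : T (isProper I) → ∃ λ x → ¬ T (x ∈ᵇ I)
    isProper⁻ pr = let x , x∉ = anyF⁻ notElement pr in x , T-not⁻ x∉

  ∈⟨⟩-self : ∀ {c} → c < N → T ((c mod N) ∈ᵇ ⟨ c ⟩)
  ∈⟨⟩-self {c} c<N = ∈⟨⟩⁺ {c} (c mod N) (subst (c ∣_) (sym (toℕ-mod-< c<N)) ∣-refl)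

  mod≢0 : ∀ {x} → 0 < x → x < N → x mod N ≢ 0ₙ
  mod≢0 {x} 0<x x<N eq = <⇒≢ 0<x (sym (trans (sym (toℕ-mod-< x<N)) (cong toℕ eq)))

  ⟨⟩-isNonzero : ∀ {c} → 0 < c → c < N → T (isNonzero ⟨ c ⟩)
  ⟨⟩-isNonzero {c} 0<c c<N = isNonzero⁺ {⟨ c ⟩} (c mod N) (∈⟨⟩-self c<N) (mod≢0 0<c c<N)

  nonzero-multiple⇒< : ∀ {c} x → c ∣ toℕ x → x ≢ 0ₙ → c < N
  nonzero-multiple⇒< {c} fzero    _   x≢0 = ⊥-elim (x≢0 refl)
  nonzero-multiple⇒< {c} (fsuc x) c∣x _   = ≤-<-trans (∣⇒≤ c∣x) (toℕ<n (fsuc x))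

  isNonzero⟨⟩⇒< : ∀ {c} → T (isNonzero ⟨ c ⟩) → c < N
  isNonzero⟨⟩⇒< {c} nz = let x , x∈ , x≢0 = isNonzero⁻ {⟨ c ⟩} nz in nonzero-multiple⇒< x (∈⟨⟩⁻ x x∈) x≢0

  ⟨⟩-isProper : ∀ {c} → 1 < N → c ≢ 1 → T (isProper ⟨ c ⟩)
  ⟨⟩-isProper {c} 1<N c≢1 = isProper⁺ {⟨ c ⟩} (1 mod N)
    λ 1∈ → c≢1 (∣1⇒≡1 (subst (c ∣_) (toℕ-mod-< 1<N) (∈⟨⟩⁻ (1 mod N) 1∈)))

  isProper⟨⟩⇒≢1 : ∀ {c} → T (isProper ⟨ c ⟩) → c ≢ 1
  isProper⟨⟩⇒≢1 {c} pr refl = let x , x∉ = isProper⁻ {⟨ 1 ⟩} pr in x∉ (∈⟨⟩⁺ x (1∣ toℕ x))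

  ⟨⟩-injective : ∀ {c e} → c < N → e < N → ⟨ c ⟩ ≡ ⟨ e ⟩ → c ≡ e
  ⟨⟩-injective c<N e<N ⟨c⟩≡⟨e⟩ =
    ∣-antisym (divides-other c<N e<N ⟨c⟩≡⟨e⟩) (divides-other e<N c<N (sym ⟨c⟩≡⟨e⟩))
    where
    divides-other : ∀ {c e} → c < N → e < N → ⟨ c ⟩ ≡ ⟨ e ⟩ → c ∣ e
    divides-other {c} {e} c<N e<N ⟨c⟩≡⟨e⟩ = subst (c ∣_) (toℕ-mod-< e<N)
      (∈⟨⟩⁻ (e mod N) (subst (λ I → T ((e mod N) ∈ᵇ I)) (sym ⟨c⟩≡⟨e⟩) (∈⟨⟩-self e<N)))

  CommonMultiple<N : ℕ → ℕ → Set
  CommonMultiple<N c e = ∃ λ x → 0 < x × x < N × c ∣ x × e ∣ x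

  module _ {c e : ℕ} where
    private
      lookup-∩ : ∀ x → x ∈ᵇ (⟨ c ⟩ ∩ₙ ⟨ e ⟩) ≡ (x ∈ᵇ ⟨ c ⟩) ∧ (x ∈ᵇ ⟨ e ⟩)
      lookup-∩ x = lookup∘tabulate (λ x → (x ∈ᵇ ⟨ c ⟩) ∧ (x ∈ᵇ ⟨ e ⟩)) x

    ∩-isNonzero⁺ : CommonMultiple<N c e → T (isNonzero (⟨ c ⟩ ∩ₙ ⟨ e ⟩))
    ∩-isNonzero⁺ (x , 0<x , x<N , c∣x , e∣x) = isNonzero⁺ {⟨ c ⟩ ∩ₙ ⟨ e ⟩} (x mod N)
      (subst T (sym (lookup-∩ (x mod N))) (∧⁺ {(x mod N) ∈ᵇ ⟨ c ⟩}
        (∈⟨⟩⁺ (x mod N) (subst (c ∣_) (sym (toℕ-mod-< x<N)) c∣x))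
        (∈⟨⟩⁺ (x mod N) (subst (e ∣_) (sym (toℕ-mod-< x<N)) e∣x))))
      (mod≢0 0<x x<N)

    ∩-isNonzero⁻ : T (isNonzero (⟨ c ⟩ ∩ₙ ⟨ e ⟩)) → CommonMultiple<N c e
    ∩-isNonzero⁻ nz with isNonzero⁻ {⟨ c ⟩ ∩ₙ ⟨ e ⟩} nz
    ... | fzero , _ , x≢0 = ⊥-elim (x≢0 refl)
    ... | x@(fsuc _) , x∈ , _ =
      let x∈c , x∈e = ∧⁻ {x ∈ᵇ ⟨ c ⟩} (subst T (lookup-∩ x) x∈)
      in toℕ x , s≤s z≤n , toℕ<n x , ∈⟨⟩⁻ x x∈c , ∈⟨⟩⁻ x x∈e

  extensions : ∀ {m} → Vec Bool m → List (Vec Bool (suc m))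
  extensions s = (true ∷ s) List.∷ (false ∷ s) List.∷ List.[]

  subsets-complete : ∀ m (v : Vec Bool m) → v ∈ subsets m
  subsets-complete zero    []      = here refl
  subsets-complete (suc m) (b ∷ v) = go (subsets m) (subsets-complete m v)
    where
    ∈extensions : ∀ b → (b ∷ v) ∈ extensions v
    ∈extensions true  = here refl
    ∈extensions false = there (here refl)
    go : ∀ vs → v ∈ vs → (b ∷ v) ∈ concatMap extensions vs
    go (_ List.∷ _)  (here refl) = ∈-++⁺ˡ (∈extensions b)
    go (w List.∷ vs) (there v∈)  = ∈-++⁺ʳ (extensions w) (go vs v∈)

  subsets-unique : ∀ m → Unique (subsets m)
  subsets-unique zero    = All.[] ∷ []
  subsets-unique (suc m) = concat⁺ (All.map⁺ (All.tabulate λ {s} _ → extensions-unique s))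
    (AllPairs.map⁺ (AllPairs.map extensions-disjoint (subsets-unique m)))
    where
    extensions-unique : ∀ s → Unique (extensions s)
    extensions-unique s = ((λ ()) All.∷ All.[]) ∷ (All.[] ∷ [])
    extensions-disjoint : ∀ {s t} → s ≢ t → Disjoint (extensions s) (extensions t)
    extensions-disjoint s≢t (here refl         , here refl)         = s≢t refl
    extensions-disjoint s≢t (there (here refl) , there (here refl)) = s≢t refl
    extensions-disjoint _   (here refl         , there (here ()))
    extensions-disjoint _   (there (here refl) , here ())
    extensions-disjoint _   (_                 , there (there ()))
    extensions-disjoint _   (there (there ())  , _)

  module _ {I : SubsetN} where
    private
      meets : SubsetN → Bool
      meets J = (isIdeal J ∧ isNonzero J) ⇒ᵇ isNonzero (I ∩ₙ J)

    isEssential⁺ : (∀ J → T (isIdeal J) → T (isNonzero J) → T (isNonzero (I ∩ₙ J))) → T (isEssential I)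
    isEssential⁺ meets-all = All.all⁻ meets {allSubsets} (All.tabulate λ {J} _ →
      ⇒ᵇ⁺ {isIdeal J ∧ isNonzero J} λ J-ideal,J≢0 →
        let J-ideal , J≢0 = ∧⁻ {isIdeal J} J-ideal,J≢0 in meets-all J J-ideal J≢0)

    isEssential⁻ : T (isEssential I) → ∀ J → T (isIdeal J) → T (isNonzero J) → T (isNonzero (I ∩ₙ J))
    isEssential⁻ ess J J-ideal J≢0 = ⇒ᵇ⁻ {isIdeal J ∧ isNonzero J}
      (All.lookup (All.all⁺ meets allSubsets ess) (subsets-complete N J)) (∧⁺ {isIdeal J} J-ideal J≢0)

  module _ (g : ℕ) where

    isEssential⟨⟩⁺ : (∀ e → e ∣ N → e < N → CommonMultiple<N g e) → T (isEssential ⟨ g ⟩)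
    isEssential⟨⟩⁺ common = isEssential⁺ {⟨ g ⟩} λ J J-ideal J≢0 →
      let e , e∣N , J≡⟨e⟩ = isIdeal⇒≡⟨⟩ {J} J-ideal
          e<N = isNonzero⟨⟩⇒< {e} (subst (T ∘ isNonzero) J≡⟨e⟩ J≢0)
      in subst (λ J → T (isNonzero (⟨ g ⟩ ∩ₙ J))) (sym J≡⟨e⟩) (∩-isNonzero⁺ (common e e∣N e<N))

    isEssential⟨⟩⁻ : T (isEssential ⟨ g ⟩) → ∀ e → e ∣ N → e < N → CommonMultiple<N g e
    isEssential⟨⟩⁻ ess e e∣N e<N = ∩-isNonzero⁻
      (isEssential⁻ {⟨ g ⟩} ess ⟨ e ⟩ (⟨⟩-isIdeal e∣N) (⟨⟩-isNonzero (∣suc⇒0< e∣N) e<N))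

-- An exponent (i , j) stands for the divisor p ^ i * q ^ j of N = p ^ a * q ^ b.  The nonzero proper ideals of ℤ_N
-- are the multiples of the divisors with exponent in grid, and Adjacent is the adjacency of their essential ideal graph.
module ExponentBox (a′ b′ : ℕ) where
  open import Data.Bool using (if_then_else_)
  open import Data.Nat
  open import Data.Nat.Properties
  open import Data.Nat.Tactic.RingSolver using (solve-∀)
  open import Data.List using (List; map; upTo; drop; cartesianProduct; _++_; length)
  open import Data.List.Properties using (length-map; length-upTo)
  open import Data.List.Membership.Propositional using (_∈_; _∉_)
  open import Data.List.Membership.Propositional.Properties
    using (∈-++⁻; ∈-++⁺ˡ; ∈-++⁺ʳ; ∈-map⁺; ∈-map⁻; ∈-upTo⁺; ∈-upTo⁻)
    renaming (∈-cartesianProduct⁺ to ∈-×⁺; ∈-cartesianProduct⁻ to ∈-×⁻)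
  open import Data.List.Relation.Unary.Any using (here; there)
  import Data.List.Relation.Unary.All as All
  open import Data.List.Relation.Unary.AllPairs using (_∷_)
  open import Data.List.Relation.Unary.Unique.Propositional using (Unique)
  open import Data.List.Relation.Unary.Unique.Propositional.Properties
    using (++⁺; upTo⁺; cartesianProduct⁺; drop⁺) renaming (map⁺ to unique-map⁺)
  open import Data.List.Relation.Binary.Disjoint.Propositional using (Disjoint)
  open import Data.Product using (∃; _×_; _,_; proj₁; proj₂; swap)
  open import Data.Product.Properties using (≡-dec)
  open import Data.Sum using (_⊎_; inj₁; inj₂; [_,_]′)
  open import Data.Empty using (⊥-elim)
  open import Function using (_∘_)
  open import Relation.Nullary using (Dec; yes; no; does; ¬_; ¬?)
  open import Relation.Nullary.Decidable using (_×-dec_)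
  open import Relation.Binary.PropositionalEquality
  open Booleans using (does⁺; does⁻; if-T; if-¬T)
  open ListSums

  a b : ℕ
  a = suc a′
  b = suc b′

  Exponent : Set
  Exponent = ℕ × ℕ

  InBox : Exponent → Set
  InBox (i , j) = i ≤ a × j ≤ b

  Adjacent : Exponent → Exponent → Set
  Adjacent (i , j) (i′ , j′) = ¬ (i ≡ a × i′ ≡ a) × ¬ (j ≡ b × j′ ≡ b)

  adjacent? : ∀ u v → Dec (Adjacent u v)
  adjacent? (i , j) (i′ , j′) = ¬? ((i ≟ a) ×-dec (i′ ≟ a)) ×-dec ¬? ((j ≟ b) ×-dec (j′ ≟ b))

  rowA colB inner grid : List Exponent
  rowA  = map (a ,_) (upTo b)
  colB  = map (_, b) (upTo a)
  -- drops the pair (0 , 0), which comes first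
  inner = drop 1 (cartesianProduct (upTo a) (upTo b))
  grid  = rowA ++ colB ++ inner

  ∈rowA⁻ : ∀ {u} → u ∈ rowA → proj₁ u ≡ a × proj₂ u < b
  ∈rowA⁻ u∈ with ∈-map⁻ (a ,_) u∈
  ... | j , j∈ , refl = refl , ∈-upTo⁻ j∈

  ∈colB⁻ : ∀ {u} → u ∈ colB → proj₁ u < a × proj₂ u ≡ b
  ∈colB⁻ u∈ with ∈-map⁻ (_, b) u∈
  ... | i , i∈ , refl = ∈-upTo⁻ i∈ , refl

  ∈inner⁻ : ∀ {u} → u ∈ inner → proj₁ u < a × proj₂ u < b
  ∈inner⁻ {i , j} u∈ = let i∈ , j∈ = ∈-×⁻ (upTo a) (upTo b) (there u∈) in ∈-upTo⁻ i∈ , ∈-upTo⁻ j∈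

  0,0∉inner : (0 , 0) ∉ inner
  0,0∉inner with cartesianProduct⁺ (upTo⁺ a) (upTo⁺ b)
  ... | 0,0∉ ∷ _ = λ 0,0∈ → All.lookup 0,0∉ 0,0∈ refl

  rowA-unique : Unique rowA
  rowA-unique = unique-map⁺ (cong proj₂) (upTo⁺ b)

  colB-unique : Unique colB
  colB-unique = unique-map⁺ (cong proj₁) (upTo⁺ a)

  inner-unique : Unique inner
  inner-unique = drop⁺ 1 (cartesianProduct⁺ (upTo⁺ a) (upTo⁺ b))

  grid-unique : Unique grid
  grid-unique = ++⁺ rowA-unique (++⁺ colB-unique inner-unique colB∩inner) rowA∩rest
    where
    colB∩inner : Disjoint colB inner
    colB∩inner (u∈colB , u∈inner) = <-irrefl (proj₂ (∈colB⁻ u∈colB)) (proj₂ (∈inner⁻ u∈inner))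
    rowA∩rest : Disjoint rowA (colB ++ inner)
    rowA∩rest (u∈rowA , u∈rest) with ∈-++⁻ colB u∈rest
    ... | inj₁ u∈colB  = <-irrefl (proj₁ (∈rowA⁻ u∈rowA)) (proj₁ (∈colB⁻ u∈colB))
    ... | inj₂ u∈inner = <-irrefl (proj₁ (∈rowA⁻ u∈rowA)) (proj₁ (∈inner⁻ u∈inner))

  ∈grid⁻ : ∀ {u} → u ∈ grid → InBox u × u ≢ (0 , 0) × u ≢ (a , b)
  ∈grid⁻ {i , j} u∈ with ∈-++⁻ rowA u∈
  ... | inj₁ u∈rowA = let i≡a , j<b = ∈rowA⁻ u∈rowA
                      in (≤-reflexive i≡a , <⇒≤ j<b) , (λ { refl → 0≢1+n i≡a }) , λ { refl → <-irrefl refl j<b }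
  ... | inj₂ u∈rest with ∈-++⁻ colB u∈rest
  ...   | inj₁ u∈colB  = let i<a , j≡b = ∈colB⁻ u∈colB
                         in (<⇒≤ i<a , ≤-reflexive j≡b) , (λ { refl → 0≢1+n j≡b }) , λ { refl → <-irrefl refl i<a }
  ...   | inj₂ u∈inner = let i<a , j<b = ∈inner⁻ u∈inner
                         in (<⇒≤ i<a , <⇒≤ j<b) , (λ { refl → 0,0∉inner u∈inner }) , λ { refl → <-irrefl refl i<a }

  ∈grid⁺ : ∀ {u} → InBox u → u ≢ (0 , 0) → u ≢ (a , b) → u ∈ grid
  ∈grid⁺ {i , j} (i≤a , j≤b) ≢0,0 ≢a,b with m≤n⇒m<n∨m≡n i≤a | m≤n⇒m<n∨m≡n j≤b
  ... | inj₂ refl | inj₂ refl = ⊥-elim (≢a,b refl)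
  ... | inj₂ refl | inj₁ j<b  = ∈-++⁺ˡ (∈-map⁺ (a ,_) (∈-upTo⁺ j<b))
  ... | inj₁ i<a  | inj₂ refl = ∈-++⁺ʳ rowA (∈-++⁺ˡ (∈-map⁺ (_, b) (∈-upTo⁺ i<a)))
  ... | inj₁ i<a  | inj₁ j<b  with ∈-×⁺ (∈-upTo⁺ i<a) (∈-upTo⁺ j<b)
  ...   | here refl = ⊥-elim (≢0,0 refl)
  ...   | there u∈inner = ∈-++⁺ʳ rowA (∈-++⁺ʳ colB u∈inner)

  _≟ₑ_ : (u v : Exponent) → Dec (u ≡ v)
  _≟ₑ_ = ≡-dec _≟_ _≟_

  Δ : Exponent → Exponent → ℕ
  Δ u v = if does (u ≟ₑ v) then 0 else if does (adjacent? u v) then 1 else 2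

  module _ {u v : Exponent} where

    Δ-adjacent : u ≢ v → Adjacent u v → Δ u v ≡ 1
    Δ-adjacent u≢v u~v = trans (if-¬T (u≢v ∘ does⁻ (u ≟ₑ v))) (if-T (does⁺ (adjacent? u v) u~v))

    Δ-nonadjacent : u ≢ v → ¬ Adjacent u v → Δ u v ≡ 2
    Δ-nonadjacent u≢v u≁v = trans (if-¬T (u≢v ∘ does⁻ (u ≟ₑ v))) (if-¬T (u≁v ∘ does⁻ (adjacent? u v)))

  Δ-refl : ∀ u → Δ u u ≡ 0
  Δ-refl u = if-T (does⁺ (u ≟ₑ u) refl)

  adjacent-sym : ∀ {u v} → Adjacent u v → Adjacent v u
  adjacent-sym (¬a , ¬b) = ¬a ∘ swap , ¬b ∘ swap

  Δ-sym : ∀ u v → Δ u v ≡ Δ v u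
  Δ-sym u v = by-cases (u ≟ₑ v) (adjacent? u v)
    where
    by-cases : Dec (u ≡ v) → Dec (Adjacent u v) → Δ u v ≡ Δ v u
    by-cases (yes refl) _         = refl
    by-cases (no u≢v)   (yes u~v) = trans (Δ-adjacent u≢v u~v) (sym (Δ-adjacent (u≢v ∘ sym) (adjacent-sym u~v)))
    by-cases (no u≢v)   (no u≁v)  = trans (Δ-nonadjacent u≢v u≁v) (sym (Δ-nonadjacent (u≢v ∘ sym) (u≁v ∘ adjacent-sym)))

  nonadjacent⇒ : ∀ {u v} → ¬ Adjacent u v → (proj₁ u ≡ a × proj₁ v ≡ a) ⊎ (proj₂ u ≡ b × proj₂ v ≡ b)
  nonadjacent⇒ {i , j} {i′ , j′} u≁v with (i ≟ a) ×-dec (i′ ≟ a) | (j ≟ b) ×-dec (j′ ≟ b)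
  ... | yes i,i′≡a | _          = inj₁ i,i′≡a
  ... | no _       | yes j,j′≡b = inj₂ j,j′≡b
  ... | no ¬i,i′≡a | no ¬j,j′≡b = ⊥-elim (u≁v (¬i,i′≡a , ¬j,j′≡b))

  ∈grid-rowA⇒< : ∀ {j} → (a , j) ∈ grid → j < b
  ∈grid-rowA⇒< u∈ = let (_ , j≤b) , _ , ≢a,b = ∈grid⁻ u∈ in ≤∧≢⇒< j≤b (≢a,b ∘ cong (a ,_))

  ∈grid-colB⇒< : ∀ {i} → (i , b) ∈ grid → i < a
  ∈grid-colB⇒< u∈ = let (i≤a , _) , _ , ≢a,b = ∈grid⁻ u∈ in ≤∧≢⇒< i≤a (≢a,b ∘ cong (_, b))

  -- the common neighbour is q ^ b ℤ_N or p ^ a ℤ_N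
  common-neighbour : ∀ {u v} → u ∈ grid → v ∈ grid → ¬ Adjacent u v →
                     ∃ λ w → w ∈ grid × u ≢ w × w ≢ v × Adjacent u w × Adjacent w v
  common-neighbour {i , j} {i′ , j′} u∈ v∈ u≁v with nonadjacent⇒ {i , j} {i′ , j′} u≁v
  ... | inj₁ (refl , refl) =
    (0 , b) , ∈grid⁺ (z≤n , ≤-refl) (λ ()) (λ ()) , (λ ()) , (λ ())
            , ((λ { (_ , ()) }) , λ (j≡b , _) → <-irrefl j≡b (∈grid-rowA⇒< u∈))
            , ((λ { (() , _) }) , λ (_ , j′≡b) → <-irrefl j′≡b (∈grid-rowA⇒< v∈))
  ... | inj₂ (refl , refl) =
    (a , 0) , ∈grid⁺ (≤-refl , z≤n) (λ ()) (λ ()) , (λ ()) , (λ ())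
            , ((λ (i≡a , _) → <-irrefl i≡a (∈grid-colB⇒< u∈)) , λ { (_ , ()) })
            , ((λ (_ , i′≡a) → <-irrefl i′≡a (∈grid-colB⇒< v∈)) , λ { (() , _) })

  Δ+Δ² : Exponent → Exponent → ℕ
  Δ+Δ² u v = Δ u v + Δ u v * Δ u v

  module _ {u v : Exponent} (u≢v : u ≢ v) where

    Δ+Δ²-adjacent : Adjacent u v → Δ+Δ² u v ≡ 2
    Δ+Δ²-adjacent u~v rewrite Δ-adjacent u≢v u~v = refl

    Δ+Δ²-nonadjacent : ¬ Adjacent u v → Δ+Δ² u v ≡ 6
    Δ+Δ²-nonadjacent u≁v rewrite Δ-nonadjacent u≢v u≁v = refl

  Δ+Δ²-refl : ∀ u → Δ+Δ² u u ≡ 0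
  Δ+Δ²-refl u rewrite Δ-refl u = refl

  block : List Exponent → List Exponent → ℕ
  block xs ys = ∑[ u ∈ xs ] ∑[ v ∈ ys ] Δ+Δ² u v

  block-sym : ∀ xs ys → block xs ys ≡ block ys xs
  block-sym xs ys = trans (∑-comm xs ys Δ+Δ²)
    (∑-cong ys λ {v} _ → ∑-cong xs λ {u} _ → cong₂ (λ d e → d + d * e) (Δ-sym u v) (Δ-sym u v))

  diagonal-block : ∀ {xs} c → Unique xs → (∀ {u v} → u ∈ xs → v ∈ xs → u ≢ v → Δ+Δ² u v ≡ c) →
                   block xs xs + length xs * c ≡ length xs * (length xs * c)
  diagonal-block c xs-unique off-diagonal = ∑∑-off-diagonal c xs-unique (λ {u} _ → Δ+Δ²-refl u) off-diagonal

  cross-block : ∀ xs ys → (∀ {u v} → u ∈ xs → v ∈ ys → u ≢ v × Adjacent u v) →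
                block xs ys ≡ length xs * (length ys * 2)
  cross-block xs ys separated = ∑∑-const xs ys 2 λ u∈ v∈ →
    let u≢v , u~v = separated u∈ v∈ in Δ+Δ²-adjacent u≢v u~v

  length-rowA : length rowA ≡ b
  length-rowA = trans (length-map (λ (j : ℕ) → a , j) (upTo b)) (length-upTo b)

  length-colB : length colB ≡ a
  length-colB = trans (length-map (λ (i : ℕ) → i , b) (upTo a)) (length-upTo a)

  1+length-inner : suc (length inner) ≡ a * b
  1+length-inner = trans (length-cartesianProduct (upTo a) (upTo b)) (cong₂ _*_ (length-upTo a) (length-upTo b))

  private
    fst≢ : ∀ {u v : Exponent} → proj₁ u ≡ a → proj₁ v < a → u ≢ v
    fst≢ u≡a v<a refl = <-irrefl u≡a v<a
    snd≢ : ∀ {u v : Exponent} → proj₂ u ≡ b → proj₂ v < b → u ≢ v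
    snd≢ u≡b v<b refl = <-irrefl u≡b v<b
    adjacent-if : ∀ {u v : Exponent} → proj₁ u < a ⊎ proj₁ v < a → proj₂ u < b ⊎ proj₂ v < b → Adjacent u v
    adjacent-if fst< snd< = (λ (u≡a , v≡a) → [ <-irrefl u≡a , <-irrefl v≡a ]′ fst<)
                          , (λ (u≡b , v≡b) → [ <-irrefl u≡b , <-irrefl v≡b ]′ snd<)

  block-rowA : block rowA rowA + b * 6 ≡ b * (b * 6)
  block-rowA = subst (λ n → block rowA rowA + n * 6 ≡ n * (n * 6)) length-rowA
    (diagonal-block 6 rowA-unique λ u∈ v∈ u≢v →
      Δ+Δ²-nonadjacent u≢v λ (¬both-a , _) → ¬both-a (proj₁ (∈rowA⁻ u∈) , proj₁ (∈rowA⁻ v∈)))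

  block-colB : block colB colB + a * 6 ≡ a * (a * 6)
  block-colB = subst (λ n → block colB colB + n * 6 ≡ n * (n * 6)) length-colB
    (diagonal-block 6 colB-unique λ u∈ v∈ u≢v →
      Δ+Δ²-nonadjacent u≢v λ (_ , ¬both-b) → ¬both-b (proj₂ (∈colB⁻ u∈) , proj₂ (∈colB⁻ v∈)))

  block-inner : block inner inner + length inner * 2 ≡ length inner * (length inner * 2)
  block-inner = diagonal-block 2 inner-unique λ u∈ v∈ u≢v →
    Δ+Δ²-adjacent u≢v (adjacent-if (inj₁ (proj₁ (∈inner⁻ u∈))) (inj₁ (proj₂ (∈inner⁻ u∈))))

  block-rowA-colB : block rowA colB ≡ b * (a * 2)
  block-rowA-colB = trans (cross-block rowA colB λ u∈ v∈ →
      fst≢ (proj₁ (∈rowA⁻ u∈)) (proj₁ (∈colB⁻ v∈))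
    , adjacent-if (inj₂ (proj₁ (∈colB⁻ v∈))) (inj₁ (proj₂ (∈rowA⁻ u∈))))
    (cong₂ (λ m n → m * (n * 2)) length-rowA length-colB)

  block-rowA-inner : block rowA inner ≡ b * (length inner * 2)
  block-rowA-inner = trans (cross-block rowA inner λ u∈ v∈ →
      fst≢ (proj₁ (∈rowA⁻ u∈)) (proj₁ (∈inner⁻ v∈))
    , adjacent-if (inj₂ (proj₁ (∈inner⁻ v∈))) (inj₁ (proj₂ (∈rowA⁻ u∈))))
    (cong (λ m → m * (length inner * 2)) length-rowA)

  block-colB-inner : block colB inner ≡ a * (length inner * 2)
  block-colB-inner = trans (cross-block colB inner λ u∈ v∈ →
      snd≢ (proj₂ (∈colB⁻ u∈)) (proj₂ (∈inner⁻ v∈))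
    , adjacent-if (inj₁ (proj₁ (∈colB⁻ u∈))) (inj₂ (proj₂ (∈inner⁻ v∈))))
    (cong (λ m → m * (length inner * 2)) length-colB)

  block-++ʳ : ∀ xs ys zs → block xs (ys ++ zs) ≡ block xs ys + block xs zs
  block-++ʳ xs ys zs = trans (∑-cong xs λ {u} _ → ∑-++ ys zs (Δ+Δ² u))
    (∑-+ xs (λ u → ∑ ys (Δ+Δ² u)) (λ u → ∑ zs (Δ+Δ² u)))

  block-3×3 : ∀ xs ys zs → let ws = xs ++ ys ++ zs in
    block ws ws ≡ (block xs xs + (block xs ys + block xs zs))
                + ((block ys xs + (block ys ys + block ys zs)) + (block zs xs + (block zs ys + block zs zs)))
  block-3×3 xs ys zs = trans (∑-++ xs (ys ++ zs) _) (cong₂ _+_ (row xs)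
                         (trans (∑-++ ys zs _) (cong₂ _+_ (row ys) (row zs))))
    where
    row : ∀ vs → block vs (xs ++ ys ++ zs) ≡ block vs xs + (block vs ys + block vs zs)
    row vs = trans (block-++ʳ vs xs (ys ++ zs)) (cong (block vs xs +_) (block-++ʳ vs ys zs))

  -- twice the numerator of the formula, with 2 (a b + 5 (a + b)) moved to the left so that no subtraction occurs
  ∑∑Δ+Δ² : block grid grid + 2 * (a * b + 5 * (a + b))
           ≡ 2 * (a * b * (a * b) + 2 * (a * b) * (a + b) + 3 * (a * a + b * b) + 2)
  ∑∑Δ+Δ² = begin
    block grid grid + 2 * (a * b + 5 * (a + b))
      ≡⟨ cong₂ (λ B P → B + 2 * (P + 5 * (a + b))) (block-3×3 rowA colB inner) (sym 1+x≡ab) ⟩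
    (PP + (PQ + PX)) + ((QP + (QQ + QX)) + (XP + (XQ + XX))) + 2 * (suc x + 5 * (a + b))
      ≡⟨ cong (λ B → B + 2 * (suc x + 5 * (a + b))) (cong₂ _+_
           (cong (PP +_) (cong₂ _+_ block-rowA-colB block-rowA-inner))
           (cong₂ _+_ (cong₂ _+_ (trans (block-sym colB rowA) block-rowA-colB) (cong (QQ +_) block-colB-inner))
                      (cong₂ _+_ (trans (block-sym inner rowA) block-rowA-inner)
                                 (cong (_+ XX) (trans (block-sym inner colB) block-colB-inner))))) ⟩
    (PP + (b * (a * 2) + b * (x * 2))) + ((b * (a * 2) + (QQ + a * (x * 2))) + (b * (x * 2) + (a * (x * 2) + XX)))
      + 2 * (suc x + 5 * (a + b))
      ≡⟨ regroup PP QQ XX a b x ⟩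
    (PP + b * 6) + (QQ + a * 6) + (XX + x * 2) + 4 * (a * b + a * x + b * x) + (2 + 4 * a + 4 * b)
      ≡⟨ cong₂ (λ B P → B + 4 * (P + a * x + b * x) + (2 + 4 * a + 4 * b))
               (cong₂ _+_ (cong₂ _+_ block-rowA block-colB) block-inner) (sym 1+x≡ab) ⟩
    b * (b * 6) + a * (a * 6) + x * (x * 2) + 4 * (suc x + a * x + b * x) + (2 + 4 * a + 4 * b)
      ≡⟨ expand a b x ⟩
    2 * (suc x * suc x + 2 * suc x * (a + b) + 3 * (a * a + b * b) + 2)
      ≡⟨ cong (λ P → 2 * (P * P + 2 * P * (a + b) + 3 * (a * a + b * b) + 2)) 1+x≡ab ⟩
    2 * (a * b * (a * b) + 2 * (a * b) * (a + b) + 3 * (a * a + b * b) + 2) ∎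
    where
    open ≡-Reasoning
    x PP PQ PX QP QQ QX XP XQ XX : ℕ
    x = length inner
    1+x≡ab : suc x ≡ a * b
    1+x≡ab = 1+length-inner
    PP = block rowA rowA
    PQ = block rowA colB
    PX = block rowA inner
    QP = block colB rowA
    QQ = block colB colB
    QX = block colB inner
    XP = block inner rowA
    XQ = block inner colB
    XX = block inner inner
    regroup : ∀ PP QQ XX a b x →
      (PP + (b * (a * 2) + b * (x * 2))) + ((b * (a * 2) + (QQ + a * (x * 2))) + (b * (x * 2) + (a * (x * 2) + XX)))
        + 2 * (suc x + 5 * (a + b))
      ≡ (PP + b * 6) + (QQ + a * 6) + (XX + x * 2) + 4 * (a * b + a * x + b * x) + (2 + 4 * a + 4 * b)
    regroup = solve-∀
    expand : ∀ a b x → b * (b * 6) + a * (a * 6) + x * (x * 2) + 4 * (suc x + a * x + b * x) + (2 + 4 * a + 4 * b)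
                       ≡ 2 * (suc x * suc x + 2 * suc x * (a + b) + 3 * (a * a + b * b) + 2)
    expand = solve-∀

module TwoPrimePowers (p q a′ b′ k : ℕ) (pp : Prime p) (pq : Prime q) (p≢q : p ≢ q)
                      (N≡ : suc k ≡ p ^ suc a′ * q ^ suc b′) where
  open import Data.Bool using (T)
  open import Data.Nat
  open import Data.Nat.Properties
  open import Data.Nat.Divisibility
  open import Data.Nat.Primality using (prime⇒nonZero)
  open import Data.Nat.GCD using (gcd; gcd[m,n]∣m; gcd[m,n]∣n; gcd-greatest)
  open import Data.List.Membership.Propositional using (_∈_)
  open import Data.Product using (∃₂; _×_; _,_)
  open import Function using (_∘_; _⇔_; mk⇔; Equivalence)
  open import Relation.Nullary using (yes; no; does; ¬_)
  open import Relation.Binary.PropositionalEquality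
  open import Defs
  open Booleans using (bool-ext; does⁺; does⁻)
  open NumberTheory

  open Zn k
  open Ideals k
  open ExponentBox a′ b′

  divisor : Exponent → ℕ
  divisor (i , j) = p ^ i * q ^ j

  instance
    p≢0 : NonZero p
    p≢0 = prime⇒nonZero pp
    q≢0 : NonZero q
    q≢0 = prime⇒nonZero pq

  divisor-mono : ∀ {i j i′ j′} → i ≤ i′ → j ≤ j′ → divisor (i , j) ∣ divisor (i′ , j′)
  divisor-mono i≤i′ j≤j′ = *-pres-∣ (^-monoʳ-∣ p i≤i′) (^-monoʳ-∣ q j≤j′)

  p^∣divisor : ∀ i j → p ^ i ∣ divisor (i , j)
  p^∣divisor i j = m∣m*n (q ^ j)

  q^∣divisor : ∀ i j → q ^ j ∣ divisor (i , j)
  q^∣divisor i j = n∣m*n (p ^ i)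

  p^∣divisor⇒≤ : ∀ {c i j} → p ^ c ∣ divisor (i , j) → c ≤ i
  p^∣divisor⇒≤ {c} {i} {j} = p^i∣p^i′*q^j⇒i≤i′ pp pq p≢q c i j

  q^∣divisor⇒≤ : ∀ {c i j} → q ^ c ∣ divisor (i , j) → c ≤ j
  q^∣divisor⇒≤ {c} {i} {j} = p^i∣p^i′*q^j⇒i≤i′ pq pp (p≢q ∘ sym) c j i ∘ subst (q ^ c ∣_) (*-comm (p ^ i) (q ^ j))

  divisor-injective : ∀ {u v} → divisor u ≡ divisor v → u ≡ v
  divisor-injective {i , j} {i′ , j′} eq = cong₂ _,_
    (≤-antisym (p^∣divisor⇒≤ {i} {i′} {j′} (subst (p ^ i ∣_) eq (p^∣divisor i j)))
               (p^∣divisor⇒≤ {i′} {i} {j} (subst (p ^ i′ ∣_) (sym eq) (p^∣divisor i′ j′))))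
    (≤-antisym (q^∣divisor⇒≤ {j} {i′} {j′} (subst (q ^ j ∣_) eq (q^∣divisor i j)))
               (q^∣divisor⇒≤ {j′} {i} {j} (subst (q ^ j′ ∣_) (sym eq) (q^∣divisor i′ j′))))

  divisor∣N : ∀ {i j} → i ≤ a → j ≤ b → divisor (i , j) ∣ N
  divisor∣N {i} {j} i≤a j≤b = subst (divisor (i , j) ∣_) (sym N≡) (divisor-mono i≤a j≤b)

  ∣N⇒≡divisor : ∀ {d} → d ∣ N → ∃₂ λ i j → i ≤ a × j ≤ b × d ≡ divisor (i , j)
  ∣N⇒≡divisor {d} d∣N = ∣p^a*q^b⇒≡p^i*q^j pp pq a b d (subst (d ∣_) N≡ d∣N)

  ∈grid⇒divisor∣N : ∀ {u} → u ∈ grid → divisor u ∣ N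
  ∈grid⇒divisor∣N {i , j} u∈ = let (i≤a , j≤b) , _ = ∈grid⁻ u∈ in divisor∣N i≤a j≤b

  divisor<N : ∀ {i j} → i ≤ a → j ≤ b → (i , j) ≢ (a , b) → divisor (i , j) < N
  divisor<N {i} {j} i≤a j≤b ≢ab = subst (divisor (i , j) <_) (sym N≡)
    (≤∧≢⇒< (∣⇒≤ {{N≢0}} (divisor-mono i≤a j≤b)) (≢ab ∘ divisor-injective))
    where
    N≢0 : NonZero (p ^ a * q ^ b)
    N≢0 = m*n≢0 (p ^ a) (q ^ b) {{m^n≢0 p a}} {{m^n≢0 q b}}

  ∈grid⇒divisor<N : ∀ {u} → u ∈ grid → divisor u < N
  ∈grid⇒divisor<N {i , j} u∈ = let (i≤a , j≤b) , _ , ≢a,b = ∈grid⁻ u∈ in divisor<N i≤a j≤b ≢a,b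

  p^a∣∧q^b∣⇒N∣ : ∀ {x} → p ^ a ∣ x → q ^ b ∣ x → N ∣ x
  p^a∣∧q^b∣⇒N∣ {x} p^a∣x (divides-refl t) = subst (_∣ t * q ^ b) (sym N≡)
    (*-monoˡ-∣ (q ^ b) (p^a∣q^b*k⇒p^a∣k pp pq p≢q a b t (subst (p ^ a ∣_) (*-comm t (q ^ b)) p^a∣x)))

  proper-divisor-commonMultiple : ∀ {x y g e} → x ≤ a → y ≤ b → (x , y) ≢ (a , b) →
                                  g ∣ divisor (x , y) → e ∣ divisor (x , y) → CommonMultiple<N g e
  proper-divisor-commonMultiple x≤a y≤b ≢ab g∣ e∣ =
    _ , ∣suc⇒0< (divisor∣N x≤a y≤b) , divisor<N x≤a y≤b ≢ab , g∣ , e∣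

  corner-commonMultiple : ∀ {s t i j} → s ≤ a′ → t ≤ b′ → i ≤ a → j ≤ b → (i , j) ≢ (a , b) →
                          CommonMultiple<N (divisor (s , t)) (divisor (i , j))
  corner-commonMultiple {s} {t} {i} {j} s≤a′ t≤b′ i≤a j≤b ≢ab with i ≤? a′
  ... | yes i≤a′ = proper-divisor-commonMultiple (n≤1+n a′) ≤-refl (λ ())
                     (divisor-mono s≤a′ (m≤n⇒m≤1+n t≤b′)) (divisor-mono i≤a′ j≤b)
  ... | no i≰a′ = proper-divisor-commonMultiple ≤-refl (n≤1+n b′) (λ ())
                     (divisor-mono (m≤n⇒m≤1+n s≤a′) t≤b′) (divisor-mono i≤a j≤b′)
    where
    j≤b′ : j ≤ b′
    j≤b′ = ≤-pred (≤∧≢⇒< j≤b λ j≡b → ≢ab (cong₂ _,_ (≤-antisym i≤a (≰⇒> i≰a′)) j≡b))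

  ¬commonMultiple : ∀ {g e} → p ^ a ∣ g → q ^ b ∣ e → ¬ CommonMultiple<N g e
  ¬commonMultiple p^a∣g q^b∣e (x , 0<x , x<N , g∣x , e∣x) =
    <⇒≱ x<N (∣⇒≤ {{>-nonZero 0<x}} (p^a∣∧q^b∣⇒N∣ (∣-trans p^a∣g g∣x) (∣-trans q^b∣e e∣x)))

  commonMultiple-sym : ∀ {g e} → CommonMultiple<N g e → CommonMultiple<N e g
  commonMultiple-sym (x , 0<x , x<N , g∣x , e∣x) = x , 0<x , x<N , e∣x , g∣x

  isEssential⟨⟩⇒ : ∀ {g} → T (isEssential ⟨ g ⟩) → ¬ p ^ a ∣ g × ¬ q ^ b ∣ g
  isEssential⟨⟩⇒ {g} ess =
      (λ p^a∣g → ¬commonMultiple p^a∣g ∣-refl (isEssential⟨⟩⁻ g ess (q ^ b) q^b∣N q^b<N))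
    , (λ q^b∣g → ¬commonMultiple ∣-refl q^b∣g (commonMultiple-sym (isEssential⟨⟩⁻ g ess (p ^ a) p^a∣N p^a<N)))
    where
    q^b∣N : q ^ b ∣ N
    q^b∣N = subst (_∣ N) (*-identityˡ (q ^ b)) (divisor∣N z≤n ≤-refl)
    q^b<N : q ^ b < N
    q^b<N = subst (_< N) (*-identityˡ (q ^ b)) (divisor<N z≤n ≤-refl λ ())
    p^a∣N : p ^ a ∣ N
    p^a∣N = subst (_∣ N) (*-identityʳ (p ^ a)) (divisor∣N ≤-refl z≤n)
    p^a<N : p ^ a < N
    p^a<N = subst (_< N) (*-identityʳ (p ^ a)) (divisor<N ≤-refl z≤n λ ())

  ⇒isEssential⟨⟩ : ∀ {g} → g ∣ N → ¬ p ^ a ∣ g → ¬ q ^ b ∣ g → T (isEssential ⟨ g ⟩)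
  ⇒isEssential⟨⟩ {g} g∣N p^a∤g q^b∤g with ∣N⇒≡divisor g∣N
  ... | s , t , s≤a , t≤b , refl = isEssential⟨⟩⁺ (divisor (s , t)) λ e e∣N e<N →
    let i , j , i≤a , j≤b , e≡ = ∣N⇒≡divisor e∣N
    in subst (CommonMultiple<N _) (sym e≡) (corner-commonMultiple
         (below s≤a (p^a∤g ∘ p^∣divisor′)) (below t≤b (q^b∤g ∘ q^∣divisor′)) i≤a j≤b
         λ ij≡ab → <-irrefl (trans e≡ (trans (cong divisor ij≡ab) (sym N≡))) e<N)
    where
    below : ∀ {m n} → m ≤ suc n → ¬ (m ≡ suc n) → m ≤ n
    below m≤1+n m≢1+n = ≤-pred (≤∧≢⇒< m≤1+n m≢1+n)
    p^∣divisor′ : s ≡ a → p ^ a ∣ divisor (s , t)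
    p^∣divisor′ refl = p^∣divisor a t
    q^∣divisor′ : t ≡ b → q ^ b ∣ divisor (s , t)
    q^∣divisor′ refl = q^∣divisor s b

  module _ {i j i′ j′ : ℕ} where
    private
      g : ℕ
      g = gcd (divisor (i , j)) (divisor (i′ , j′))
      g∣ˡ : g ∣ divisor (i , j)
      g∣ˡ = gcd[m,n]∣m (divisor (i , j)) (divisor (i′ , j′))
      g∣ʳ : g ∣ divisor (i′ , j′)
      g∣ʳ = gcd[m,n]∣n (divisor (i , j)) (divisor (i′ , j′))

    p^a∣gcd⇔ : i ≤ a → i′ ≤ a → p ^ a ∣ g ⇔ (i ≡ a × i′ ≡ a)
    p^a∣gcd⇔ i≤a i′≤a = mk⇔
      (λ p^a∣g → ≤-antisym i≤a (p^∣divisor⇒≤ {a} {i} {j} (∣-trans p^a∣g g∣ˡ))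
               , ≤-antisym i′≤a (p^∣divisor⇒≤ {a} {i′} {j′} (∣-trans p^a∣g g∣ʳ)))
      λ { (refl , refl) → gcd-greatest (p^∣divisor a j) (p^∣divisor a j′) }

    q^b∣gcd⇔ : j ≤ b → j′ ≤ b → q ^ b ∣ g ⇔ (j ≡ b × j′ ≡ b)
    q^b∣gcd⇔ j≤b j′≤b = mk⇔
      (λ q^b∣g → ≤-antisym j≤b (q^∣divisor⇒≤ {b} {i} {j} (∣-trans q^b∣g g∣ˡ))
               , ≤-antisym j′≤b (q^∣divisor⇒≤ {b} {i′} {j′} (∣-trans q^b∣g g∣ʳ)))
      λ { (refl , refl) → gcd-greatest (q^∣divisor i b) (q^∣divisor i′ b) }

  isEssential⊕≡adjacent : ∀ {u v} → InBox u → InBox v →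
                          isEssential (⟨ divisor u ⟩ ⊕ ⟨ divisor v ⟩) ≡ does (adjacent? u v)
  isEssential⊕≡adjacent {i , j} {i′ , j′} (i≤a , j≤b) (i′≤a , j′≤b) =
    trans (cong isEssential (⟨⟩⊕⟨⟩≡⟨gcd⟩ (divisor∣N i≤a j≤b) (divisor∣N i′≤a j′≤b))) (bool-ext
      (λ ess → let p^a∤g , q^b∤g = isEssential⟨⟩⇒ ess
               in does⁺ (adjacent? _ _) (p^a∤g ∘ Equivalence.from p^a⇔ , q^b∤g ∘ Equivalence.from q^b⇔))
      (λ adj → let ¬i,i′≡a , ¬j,j′≡b = does⁻ (adjacent? (i , j) (i′ , j′)) adj
               in ⇒isEssential⟨⟩ (∣-trans (gcd[m,n]∣m (divisor (i , j)) (divisor (i′ , j′))) (divisor∣N i≤a j≤b))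
                    (¬i,i′≡a ∘ Equivalence.to p^a⇔) (¬j,j′≡b ∘ Equivalence.to q^b⇔)))
    where
    p^a⇔ : p ^ a ∣ gcd (divisor (i , j)) (divisor (i′ , j′)) ⇔ (i ≡ a × i′ ≡ a)
    p^a⇔ = p^a∣gcd⇔ {i} {j} {i′} {j′} i≤a i′≤a
    q^b⇔ : q ^ b ∣ gcd (divisor (i , j)) (divisor (i′ , j′)) ⇔ (j ≡ b × j′ ≡ b)
    q^b⇔ = q^b∣gcd⇔ {i} {j} {i′} {j′} j≤b j′≤b

module DiameterTwo (G : FinGraph) where
  open import Data.Bool using (true; false; T; _∨_; _∧_)
  open import Data.Nat
  open import Data.Nat.Properties
  open import Data.Fin using (Fin) renaming (zero to fzero)
  open import Data.Fin.Properties using () renaming (_≟_ to _≟ᶠ_)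
  open import Data.Vec using (lookup)
  open import Data.Vec.Properties using (lookup∘tabulate)
  open import Data.Product using (∃; _×_; _,_)
  open import Data.Sum using (_⊎_; inj₁; inj₂; [_,_]′)
  open import Data.Empty using (⊥-elim)
  open import Function using (_∘_)
  open import Relation.Nullary using (yes; no; ¬_)
  open import Relation.Nullary.Decidable using (T?)
  open import Relation.Binary.PropositionalEquality
  open import Defs
  open Booleans

  open FinGraph G
  open GraphTheory G

  Reaches : ℕ → Fin size → Fin size → Set
  Reaches t u v = T (lookup (reach t u) v)

  private
    lookup-reach-suc : ∀ t u v →
      lookup (reach (suc t) u) v ≡ (lookup (reach t u) v ∨ anyF (λ w → lookup (reach t u) w ∧ adj w v))
    lookup-reach-suc t u v =
      lookup∘tabulate (λ v → lookup (reach t u) v ∨ anyF (λ w → lookup (reach t u) w ∧ adj w v)) v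

  reaches-0⁺ : ∀ u → Reaches 0 u u
  reaches-0⁺ u = subst T (sym (lookup∘tabulate (_== u) u)) (==⁺ {x = u} refl)

  reaches-0⁻ : ∀ {u v} → Reaches 0 u v → v ≡ u
  reaches-0⁻ {u} {v} r = ==⁻ (subst T (lookup∘tabulate (_== u) v) r)

  reaches-mono : ∀ {t u v} → Reaches t u v → Reaches (suc t) u v
  reaches-mono {t} {u} {v} r = subst T (sym (lookup-reach-suc t u v)) (∨⁺ˡ r)

  reaches-step : ∀ {t u w v} → Reaches t u w → T (adj w v) → Reaches (suc t) u v
  reaches-step {t} {u} {w} {v} r w~v = subst T (sym (lookup-reach-suc t u v))
    (∨⁺ʳ {lookup (reach t u) v} (anyF⁺ (λ w → lookup (reach t u) w ∧ adj w v) w (∧⁺ {lookup (reach t u) w} r w~v)))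

  reaches-1⁻ : ∀ {u v} → Reaches 1 u v → v ≡ u ⊎ T (adj u v)
  reaches-1⁻ {u} {v} r with ∨⁻ {lookup (reach 0 u) v} (subst T (lookup-reach-suc 0 u v) r)
  ... | inj₁ r₀ = inj₁ (reaches-0⁻ r₀)
  ... | inj₂ via = let w , r₀∧w~v = anyF⁻ (λ w → lookup (reach 0 u) w ∧ adj w v) via
                       r₀ , w~v = ∧⁻ {lookup (reach 0 u) w} r₀∧w~v
                   in inj₂ (subst (λ w → T (adj w v)) (reaches-0⁻ r₀) w~v)

  search-hit : ∀ {f t} → T (f t) → ∀ n → search f t n ≡ t
  search-hit     _  zero    = refl
  search-hit {f} {t} ft (suc n) with f t
  ... | true = refl

  search-miss : ∀ {f t n} → ¬ T (f t) → search f t (suc n) ≡ search f (suc t) n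
  search-miss {f} {t} ¬ft with f t
  ... | false = refl
  ... | true  = ⊥-elim (¬ft _)

  search-at-1 : ∀ {f n} → 1 ≤ n → ¬ T (f 0) → T (f 1) → search f 0 n ≡ 1
  search-at-1 {f} {suc n} _ ¬f0 f1 = trans (search-miss {f} {0} {n} ¬f0) (search-hit {f} f1 n)

  search-at-2 : ∀ {f n} → 2 ≤ n → ¬ T (f 0) → ¬ T (f 1) → T (f 2) → search f 0 n ≡ 2
  search-at-2 {f} {suc (suc n)} _ ¬f0 ¬f1 f2 =
    trans (search-miss {f} {0} {suc n} ¬f0) (trans (search-miss {f} {1} {n} ¬f1) (search-hit {f} f2 n))
  search-at-2 {n = suc zero} (s≤s ())

  distinct⇒2≤ : ∀ {n} {u v : Fin n} → u ≢ v → 2 ≤ n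
  distinct⇒2≤ {suc zero}    {fzero} {fzero} u≢v = ⊥-elim (u≢v refl)
  distinct⇒2≤ {suc (suc n)} _ = s≤s (s≤s z≤n)

  dist-refl : ∀ u → dist u u ≡ 0
  dist-refl u = search-hit (reaches-0⁺ u) size

  dist-adjacent : ∀ {u v} → u ≢ v → T (adj u v) → dist u v ≡ 1
  dist-adjacent {u} {v} u≢v u~v = search-at-1 (≤-trans (s≤s z≤n) (distinct⇒2≤ u≢v))
    (u≢v ∘ sym ∘ reaches-0⁻) (reaches-step {0} {u} (reaches-0⁺ u) u~v)

  dist-common-neighbour : ∀ {u v w} → u ≢ v → ¬ T (adj u v) → T (adj u w) → T (adj w v) → dist u v ≡ 2
  dist-common-neighbour {u} {v} u≢v u≁v u~w w~v = search-at-2 (distinct⇒2≤ u≢v)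
    (u≢v ∘ sym ∘ reaches-0⁻) ([ u≢v ∘ sym , u≁v ]′ ∘ reaches-1⁻)
    (reaches-step {1} {u} (reaches-step {0} {u} (reaches-0⁺ u) u~w) w~v)

  module _ (common-neighbour : ∀ {u v} → u ≢ v → ¬ T (adj u v) → ∃ λ w → T (adj u w) × T (adj w v)) where

    reaches-2 : ∀ u v → Reaches 2 u v
    reaches-2 u v with u ≟ᶠ v | T? (adj u v)
    ... | yes refl | _       = reaches-mono {1} {u} (reaches-mono {0} {u} (reaches-0⁺ u))
    ... | no _     | yes u~v = reaches-mono {1} {u} (reaches-step {0} {u} (reaches-0⁺ u) u~v)
    ... | no u≢v   | no u≁v  = let w , u~w , w~v = common-neighbour u≢v u≁v
                               in reaches-step {1} {u} (reaches-step {0} {u} (reaches-0⁺ u) u~w) w~v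

    connected : Connected
    connected u v = 2 , reaches-2 u v

    dist-nonadjacent : ∀ {u v} → u ≢ v → ¬ T (adj u v) → dist u v ≡ 2
    dist-nonadjacent u≢v u≁v = let w , u~w , w~v = common-neighbour u≢v u≁v
                               in dist-common-neighbour u≢v u≁v u~w w~v

module EssentialIdealGraph (p q a′ b′ k : ℕ) (pp : Prime p) (pq : Prime q) (p≢q : p ≢ q)
                           (N≡ : suc k ≡ p ^ suc a′ * q ^ suc b′) where
  open import Data.Bool using (Bool; T; not; _∧_)
  open import Data.Nat
  open import Data.Nat.Properties
  open import Data.Nat.Divisibility using (_∣_)
  open import Data.Fin using (Fin)
  open import Data.List using (map; lookup; allFin)
  open import Data.List.Membership.Propositional using (_∈_)
  open import Data.List.Membership.Propositional.Properties
    using (∈-filter⁺; ∈-filter⁻; ∈-lookup; ∈-map⁺; ∈-map⁻; ∈-allFin)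
  open import Data.List.Relation.Unary.Any using (index)
  open import Data.List.Relation.Unary.Any.Properties using (lookup-index)
  open import Data.List.Relation.Unary.Unique.Propositional using (Unique)
  open import Data.List.Relation.Unary.Unique.Propositional.Properties using (filter⁺; allFin⁺) renaming (map⁺ to unique-map⁺)
  open import Data.List.Relation.Binary.Permutation.Propositional using (_↭_)
  open import Data.List.Relation.Binary.BagAndSetEquality using (∼bag⇒↭)
  open import Data.List.Membership.Propositional.Properties.WithK using (unique∧set⇒bag)
  open import Data.Product using (∃; _×_; _,_; proj₁; proj₂)
  open import Function using (_∘_; mk⇔)
  open import Relation.Nullary using (Dec; yes; no; does; ¬_)
  open import Relation.Nullary.Decidable using (T?)
  open import Relation.Binary.PropositionalEquality
  open import Defs
  open Booleans
  open ListSums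
  open NumberTheory using (∣suc⇒0<)

  open Zn k
  open Ideals k
  open ExponentBox a′ b′
  open TwoPrimePowers p q a′ b′ k pp pq p≢q N≡

  G : FinGraph
  G = essentialIdealGraph k

  open FinGraph G
  open GraphTheory G

  isVertex : SubsetN → Bool
  isVertex I = isIdeal I ∧ isNonzero I ∧ isProper I

  vertices-unique : Unique vertices
  vertices-unique = filter⁺ (T? ∘ isVertex) (subsets-unique N)

  isVertex⇒exponent : ∀ {I} → T (isVertex I) → ∃ λ u → u ∈ grid × I ≡ ⟨ divisor u ⟩
  isVertex⇒exponent {I} I-vertex =
    let I-ideal , I≢0,I≢1 = ∧⁻ {isIdeal I} I-vertex
        I≢0 , I≢1 = ∧⁻ {isNonzero I} I≢0,I≢1
        c , c∣N , I≡⟨c⟩ = isIdeal⇒≡⟨⟩ {I} I-ideal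
        i , j , i≤a , j≤b , c≡ = ∣N⇒≡divisor c∣N
        c<N = isNonzero⟨⟩⇒< {c} (subst (T ∘ isNonzero) I≡⟨c⟩ I≢0)
        c≢1 = isProper⟨⟩⇒≢1 {c} (subst (T ∘ isProper) I≡⟨c⟩ I≢1)
    in (i , j)
     , ∈grid⁺ (i≤a , j≤b) (λ ij≡0,0 → c≢1 (trans c≡ (cong divisor ij≡0,0)))
                          (λ ij≡a,b → <-irrefl (trans c≡ (trans (cong divisor ij≡a,b) (sym N≡))) c<N)
     , trans I≡⟨c⟩ (cong ⟨_⟩ c≡)

  ⟨divisor⟩∈vertices : ∀ {u} → u ∈ grid → ⟨ divisor u ⟩ ∈ vertices
  ⟨divisor⟩∈vertices {u} u∈ = ∈-filter⁺ (T? ∘ isVertex) (subsets-complete N _)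
    (∧⁺ {isIdeal ⟨ divisor u ⟩} (⟨⟩-isIdeal u∣N)
      (∧⁺ {isNonzero ⟨ divisor u ⟩} (⟨⟩-isNonzero (∣suc⇒0< u∣N) (∈grid⇒divisor<N u∈))
        (⟨⟩-isProper 1<N (proj₁ (proj₂ (∈grid⁻ u∈)) ∘ divisor-injective))))
    where
    u∣N : divisor u ∣ N
    u∣N = ∈grid⇒divisor∣N u∈
    1<N : 1 < N
    1<N = divisor<N z≤n z≤n λ ()

  -- Opaque: the proof term reaches into the enumeration of all subsets of ℤ_N, and unfolding it is infeasible.
  opaque
    vertex-exponent : ∀ i → ∃ λ u → u ∈ grid × lookup vertices i ≡ ⟨ divisor u ⟩
    vertex-exponent i = isVertex⇒exponent (proj₂ (∈-filter⁻ (T? ∘ isVertex) {xs = allSubsets} (∈-lookup i)))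

  label : Fin size → Exponent
  label i = proj₁ (vertex-exponent i)

  label∈grid : ∀ i → label i ∈ grid
  label∈grid i = proj₁ (proj₂ (vertex-exponent i))

  vertex≡⟨divisor-label⟩ : ∀ i → lookup vertices i ≡ ⟨ divisor (label i) ⟩
  vertex≡⟨divisor-label⟩ i = proj₂ (proj₂ (vertex-exponent i))

  label-injective : ∀ {i j} → label i ≡ label j → i ≡ j
  label-injective {i} {j} eq = lookup-injective vertices-unique i j
    (trans (vertex≡⟨divisor-label⟩ i) (trans (cong (⟨_⟩ ∘ divisor) eq) (sym (vertex≡⟨divisor-label⟩ j))))

  label-surjective : ∀ {u} → u ∈ grid → ∃ λ i → label i ≡ u
  label-surjective {u} u∈ = i , divisor-injective (⟨⟩-injective (∈grid⇒divisor<N (label∈grid i)) (∈grid⇒divisor<N u∈)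
    (trans (sym (vertex≡⟨divisor-label⟩ i)) (sym (lookup-index ⟨u⟩∈))))
    where
    ⟨u⟩∈ : ⟨ divisor u ⟩ ∈ vertices
    ⟨u⟩∈ = ⟨divisor⟩∈vertices u∈
    i : Fin size
    i = index ⟨u⟩∈

  isEssential≡adjacent : ∀ i j → isEssential (lookup vertices i ⊕ lookup vertices j)
                                ≡ does (adjacent? (label i) (label j))
  isEssential≡adjacent i j =
    trans (cong₂ (λ I J → isEssential (I ⊕ J)) (vertex≡⟨divisor-label⟩ i) (vertex≡⟨divisor-label⟩ j))
          (isEssential⊕≡adjacent (proj₁ (∈grid⁻ (label∈grid i))) (proj₁ (∈grid⁻ (label∈grid j))))

  adj≡ : ∀ i j → adj i j ≡ not (i == j) ∧ does (adjacent? (label i) (label j))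
  adj≡ i j = cong (not (i == j) ∧_) (isEssential≡adjacent i j)

  adj⁺ : ∀ {i j} → i ≢ j → Adjacent (label i) (label j) → T (adj i j)
  adj⁺ {i} {j} i≢j adjacent = subst T (sym (adj≡ i j))
    (∧⁺ {not (i == j)} (T-not⁺ (i≢j ∘ ==⁻ {x = i})) (does⁺ (adjacent? (label i) (label j)) adjacent))

  adj⁻ : ∀ {i j} → T (adj i j) → Adjacent (label i) (label j)
  adj⁻ {i} {j} i~j = does⁻ (adjacent? (label i) (label j))
    (proj₂ (∧⁻ {not (i == j)} (subst T (adj≡ i j) i~j)))

  common-neighbour′ : ∀ {i j} → i ≢ j → ¬ T (adj i j) → ∃ λ w → T (adj i w) × T (adj w j)
  common-neighbour′ {i} {j} i≢j i≁j =
    index-of (common-neighbour {label i} {label j} (label∈grid i) (label∈grid j) (i≁j ∘ adj⁺ {i} {j} i≢j))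
    where
    index-of : (∃ λ u → u ∈ grid × label i ≢ u × u ≢ label j × Adjacent (label i) u × Adjacent u (label j)) →
               ∃ λ w → T (adj i w) × T (adj w j)
    index-of (u , u∈ , i↦≢u , u≢j↦ , i~u , u~j) =
      w , adj⁺ {i} {w} (i↦≢u ∘ λ i≡w → trans (cong label i≡w) w↦u)
                       (subst (Adjacent (label i)) (sym w↦u) i~u)
        , adj⁺ {w} {j} (u≢j↦ ∘ λ w≡j → trans (sym w↦u) (cong label w≡j))
                       (subst (λ v → Adjacent v (label j)) (sym w↦u) u~j)
      where
      w : Fin size
      w = proj₁ (label-surjective u∈)
      w↦u : label w ≡ u
      w↦u = proj₂ (label-surjective u∈)

  open DiameterTwo G hiding (connected)

  connected : Connected
  connected = DiameterTwo.connected G common-neighbour′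

  dist≡Δ : ∀ i j → dist i j ≡ Δ (label i) (label j)
  dist≡Δ i j = by-cases (label i ≟ₑ label j) (adjacent? (label i) (label j))
    where
    by-cases : Dec (label i ≡ label j) → Dec (Adjacent (label i) (label j)) → dist i j ≡ Δ (label i) (label j)
    by-cases (yes i↦j) _ = begin
      dist i j               ≡⟨ cong (dist i) (label-injective i↦j) ⟨
      dist i i               ≡⟨ dist-refl i ⟩
      0                      ≡⟨ Δ-refl (label i) ⟨
      Δ (label i) (label i)  ≡⟨ cong (Δ (label i)) i↦j ⟩
      Δ (label i) (label j)  ∎
      where open ≡-Reasoning
    by-cases (no i↦≢j↦) (yes adjacent) = trans
      (dist-adjacent (i↦≢j↦ ∘ cong label) (adj⁺ {i} {j} (i↦≢j↦ ∘ cong label) adjacent))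
      (sym (Δ-adjacent i↦≢j↦ adjacent))
    by-cases (no i↦≢j↦) (no nonadjacent) = trans
      (dist-nonadjacent common-neighbour′ (i↦≢j↦ ∘ cong label) (nonadjacent ∘ adj⁻ {i} {j}))
      (sym (Δ-nonadjacent i↦≢j↦ nonadjacent))

  labels↭grid : map label (allFin size) ↭ grid
  labels↭grid = ∼bag⇒↭ (unique∧set⇒bag (unique-map⁺ label-injective (allFin⁺ size)) grid-unique
    (mk⇔ (λ u∈ → let i , _ , u≡ = ∈-map⁻ label u∈ in subst (_∈ grid) (sym u≡) (label∈grid i))
         (λ u∈ → let i , i↦u = label-surjective u∈
                 in subst (_∈ map label (allFin size)) i↦u (∈-map⁺ label (∈-allFin i)))))

  ∑∑-labels : ∀ (f : Exponent → Exponent → ℕ) →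
              ∑[ i ∈ allFin size ] ∑[ j ∈ allFin size ] f (label i) (label j) ≡ ∑[ u ∈ grid ] ∑[ v ∈ grid ] f u v
  ∑∑-labels f = begin
    ∑[ i ∈ allFin size ] ∑[ j ∈ allFin size ] f (label i) (label j)
      ≡⟨ ∑-cong (allFin size) (λ {i} _ → sym (∑-map label (allFin size) (f (label i)))) ⟩
    ∑[ i ∈ allFin size ] ∑ (map label (allFin size)) (f (label i))
      ≡⟨ ∑-cong (allFin size) (λ {i} _ → ∑-↭ (f (label i)) labels↭grid) ⟩
    ∑[ i ∈ allFin size ] ∑ grid (f (label i))
      ≡⟨ ∑-map label (allFin size) (λ u → ∑ grid (f u)) ⟨
    ∑[ u ∈ map label (allFin size) ] ∑ grid (f u)
      ≡⟨ ∑-↭ (λ u → ∑ grid (f u)) labels↭grid ⟩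
    ∑[ u ∈ grid ] ∑[ v ∈ grid ] f u v
      ∎
    where open ≡-Reasoning

  2*pairSum≡ : ∀ g → g 0 ≡ 0 → 2 * pairSum g ≡ ∑[ u ∈ grid ] ∑[ v ∈ grid ] g (Δ u v)
  2*pairSum≡ g g0≡0 = begin
    2 * pairSum g
      ≡⟨ 2*∑∑upper≡∑∑ h h-sym h-diag ⟩
    ∑[ i ∈ allFin size ] ∑[ j ∈ allFin size ] h i j
      ≡⟨ ∑-cong (allFin size) (λ {i} _ → ∑-cong (allFin size) λ {j} _ → cong g (dist≡Δ i j)) ⟩
    ∑[ i ∈ allFin size ] ∑[ j ∈ allFin size ] g (Δ (label i) (label j))
      ≡⟨ ∑∑-labels (λ u v → g (Δ u v)) ⟩
    ∑[ u ∈ grid ] ∑[ v ∈ grid ] g (Δ u v)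
      ∎
    where
    open ≡-Reasoning
    h : Fin size → Fin size → ℕ
    h i j = g (dist i j)
    h-sym : ∀ i j → h i j ≡ h j i
    h-sym i j = cong g (trans (dist≡Δ i j) (trans (Δ-sym (label i) (label j)) (sym (dist≡Δ j i))))
    h-diag : ∀ i → h i i ≡ 0
    h-diag i = trans (cong g (dist-refl i)) g0≡0

  2*[W+S]≡block : 2 * (wiener + pairSum (λ d → d * d)) ≡ block grid grid
  2*[W+S]≡block = begin
    2 * (wiener + pairSum (λ d → d * d))
      ≡⟨ *-distribˡ-+ 2 wiener (pairSum (λ d → d * d)) ⟩
    2 * wiener + 2 * pairSum (λ d → d * d)
      ≡⟨ cong₂ _+_ (2*pairSum≡ (λ d → d) refl) (2*pairSum≡ (λ d → d * d) refl) ⟩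
    (∑[ u ∈ grid ] ∑ grid (Δ u)) + (∑[ u ∈ grid ] ∑[ v ∈ grid ] Δ u v * Δ u v)
      ≡⟨ ∑-+ grid (λ u → ∑ grid (Δ u)) (λ u → ∑[ v ∈ grid ] Δ u v * Δ u v) ⟨
    ∑[ u ∈ grid ] (∑ grid (Δ u) + (∑[ v ∈ grid ] Δ u v * Δ u v))
      ≡⟨ ∑-cong grid (λ {u} _ → sym (∑-+ grid (Δ u) (λ v → Δ u v * Δ u v))) ⟩
    block grid grid
      ∎
    where open ≡-Reasoning

  W+S-identity : wiener + pairSum (λ d → d * d) + (a * b + 5 * (a + b))
                 ≡ a * b * (a * b) + 2 * (a * b) * (a + b) + 3 * (a * a + b * b) + 2
  W+S-identity = *-cancelˡ-≡ (W+S + R) Q 2 (begin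
    2 * (W+S + R)            ≡⟨ *-distribˡ-+ 2 W+S R ⟩
    2 * W+S + 2 * R          ≡⟨ cong (_+ 2 * R) 2*[W+S]≡block ⟩
    block grid grid + 2 * R  ≡⟨ ∑∑Δ+Δ² ⟩
    2 * Q                    ∎)
    where
    open ≡-Reasoning
    W+S R Q : ℕ
    W+S = wiener + pairSum (λ d → d * d)
    R = a * b + 5 * (a + b)
    Q = a * b * (a * b) + 2 * (a * b) * (a + b) + 3 * (a * a + b * b) + 2

open import Defs
open import Data.Nat using (ℕ; suc; _<_; _^_; _*_; _+_; s≤s; z≤n)
open import Data.Nat.Properties using (<⇒≢)
open import Data.Nat.Primality using (Prime)
open import Data.Product using (_×_; _,_)
open import Data.Integer using (+_) renaming (_+_ to _+ℤ_; _*_ to _*ℤ_; _-_ to _-ℤ_)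
open import Data.Integer.Properties using (pos-+; pos-*)
open import Data.Integer.Tactic.RingSolver using (solve-∀)
open import Data.Rational using (½; _/_; toℚᵘ) renaming (_+_ to _+ℚ_; _*_ to _*ℚ_)
open import Data.Rational.Properties using (toℚᵘ-injective; toℚᵘ-homo-+; toℚᵘ-homo-*; toℚᵘ-fromℚᵘ)
open import Data.Rational.Unnormalised as ℚᵘ using (mkℚᵘ; *≡*)
import Data.Rational.Unnormalised.Properties as ℚᵘ
open import Relation.Binary.PropositionalEquality

-- P, s and Q stand for m₁ m₂, m₁ + m₂ and m₁² + m₂²
numerator : ∀ V P s Q → V + (P + 5 * s) ≡ P * P + 2 * P * s + 3 * Q + 2 →
            + V ≡ (+ P *ℤ (+ P -ℤ + 1)) +ℤ (+ s *ℤ (+ 2 *ℤ + P -ℤ + 5)) +ℤ (+ 3 *ℤ + Q) +ℤ + 2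
numerator V P s Q eq = begin
  + V
    ≡⟨ move (+ V) (+ P) (+ s) ⟩
  (+ V +ℤ (+ P +ℤ + 5 *ℤ + s)) -ℤ (+ P +ℤ + 5 *ℤ + s)
    ≡⟨ cong (_-ℤ (+ P +ℤ + 5 *ℤ + s)) (trans (sym lhs-cast) (trans (cong +_ eq) rhs-cast)) ⟩
  (+ P *ℤ + P +ℤ + 2 *ℤ + P *ℤ + s +ℤ + 3 *ℤ + Q +ℤ + 2) -ℤ (+ P +ℤ + 5 *ℤ + s)
    ≡⟨ regroup (+ P) (+ s) (+ Q) ⟩
  (+ P *ℤ (+ P -ℤ + 1)) +ℤ (+ s *ℤ (+ 2 *ℤ + P -ℤ + 5)) +ℤ (+ 3 *ℤ + Q) +ℤ + 2
    ∎
  where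
  open ≡-Reasoning
  lhs-cast : + (V + (P + 5 * s)) ≡ + V +ℤ (+ P +ℤ + 5 *ℤ + s)
  lhs-cast = trans (pos-+ V (P + 5 * s)) (cong (+ V +ℤ_) (trans (pos-+ P (5 * s)) (cong (+ P +ℤ_) (pos-* 5 s))))
  rhs-cast : + (P * P + 2 * P * s + 3 * Q + 2) ≡ + P *ℤ + P +ℤ + 2 *ℤ + P *ℤ + s +ℤ + 3 *ℤ + Q +ℤ + 2
  rhs-cast = begin
    + (P * P + 2 * P * s + 3 * Q + 2)
      ≡⟨ pos-+ (P * P + 2 * P * s + 3 * Q) 2 ⟩
    + (P * P + 2 * P * s + 3 * Q) +ℤ + 2
      ≡⟨ cong (_+ℤ + 2) (pos-+ (P * P + 2 * P * s) (3 * Q)) ⟩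
    + (P * P + 2 * P * s) +ℤ + (3 * Q) +ℤ + 2
      ≡⟨ cong₂ (λ y z → y +ℤ z +ℤ + 2) (pos-+ (P * P) (2 * P * s)) (pos-* 3 Q) ⟩
    + (P * P) +ℤ + (2 * P * s) +ℤ + 3 *ℤ + Q +ℤ + 2
      ≡⟨ cong₂ (λ y z → y +ℤ z +ℤ + 3 *ℤ + Q +ℤ + 2) (pos-* P P)
               (trans (pos-* (2 * P) s) (cong (_*ℤ + s) (pos-* 2 P))) ⟩
    + P *ℤ + P +ℤ + 2 *ℤ + P *ℤ + s +ℤ + 3 *ℤ + Q +ℤ + 2
      ∎
  move : ∀ V P s → V ≡ (V +ℤ (P +ℤ + 5 *ℤ s)) -ℤ (P +ℤ + 5 *ℤ s)
  move = solve-∀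
  regroup : ∀ P s Q → (P *ℤ P +ℤ + 2 *ℤ P *ℤ s +ℤ + 3 *ℤ Q +ℤ + 2) -ℤ (P +ℤ + 5 *ℤ s)
                      ≡ (P *ℤ (P -ℤ + 1)) +ℤ (s *ℤ (+ 2 *ℤ P -ℤ + 5)) +ℤ (+ 3 *ℤ Q) +ℤ + 2
  regroup = solve-∀

½w+½s≡[w+s]/2 : ∀ (w s : ℕ) → ½ *ℚ ((+ w) / 1) +ℚ ½ *ℚ ((+ s) / 1) ≡ (+ (w + s)) / 2
½w+½s≡[w+s]/2 w s = toℚᵘ-injective (begin
  toℚᵘ (½ *ℚ ((+ w) / 1) +ℚ ½ *ℚ ((+ s) / 1))
    ≈⟨ toℚᵘ-homo-+ (½ *ℚ ((+ w) / 1)) (½ *ℚ ((+ s) / 1)) ⟩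
  toℚᵘ (½ *ℚ ((+ w) / 1)) ℚᵘ.+ toℚᵘ (½ *ℚ ((+ s) / 1))
    ≈⟨ ℚᵘ.+-cong (toℚᵘ-homo-* ½ ((+ w) / 1)) (toℚᵘ-homo-* ½ ((+ s) / 1)) ⟩
  toℚᵘ ½ ℚᵘ.* toℚᵘ ((+ w) / 1) ℚᵘ.+ toℚᵘ ½ ℚᵘ.* toℚᵘ ((+ s) / 1)
    ≈⟨ ℚᵘ.+-cong (ℚᵘ.*-cong (toℚᵘ-fromℚᵘ (mkℚᵘ (+ 1) 1)) (toℚᵘ-fromℚᵘ (mkℚᵘ (+ w) 0)))
                 (ℚᵘ.*-cong (toℚᵘ-fromℚᵘ (mkℚᵘ (+ 1) 1)) (toℚᵘ-fromℚᵘ (mkℚᵘ (+ s) 0))) ⟩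
  mkℚᵘ (+ 1) 1 ℚᵘ.* mkℚᵘ (+ w) 0 ℚᵘ.+ mkℚᵘ (+ 1) 1 ℚᵘ.* mkℚᵘ (+ s) 0
    ≈⟨ *≡* (cross-multiplied (+ w) (+ s)) ⟩
  mkℚᵘ (+ (w + s)) 1
    ≈⟨ ℚᵘ.≃-sym (toℚᵘ-fromℚᵘ (mkℚᵘ (+ (w + s)) 1)) ⟩
  toℚᵘ ((+ (w + s)) / 2) ∎)
  where
  open ℚᵘ.≃-Reasoning
  cross-multiplied : ∀ W S → ((+ 1 *ℤ W) *ℤ (+ 2 *ℤ + 1) +ℤ (+ 1 *ℤ S) *ℤ (+ 2 *ℤ + 1)) *ℤ + 2
                             ≡ (W +ℤ S) *ℤ ((+ 2 *ℤ + 1) *ℤ (+ 2 *ℤ + 1))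
  cross-multiplied = solve-∀

mainTheorem15 : (p q m₁ m₂ k : ℕ) → Prime p → Prime q → p < q → 0 < m₁ → 0 < m₂
    → suc k ≡ p ^ m₁ * q ^ m₂
    → GraphTheory.Connected (essentialIdealGraph k)
      × GraphTheory.hyperWiener (essentialIdealGraph k)
        ≡ ((+ (m₁ * m₂) *ℤ (+ (m₁ * m₂) -ℤ + 1))
            +ℤ (+ (m₁ + m₂) *ℤ (+ 2 *ℤ + (m₁ * m₂) -ℤ + 5))
            +ℤ (+ 3 *ℤ + (m₁ * m₁ + m₂ * m₂))
            +ℤ + 2) / 2
mainTheorem15 p q (suc a′) (suc b′) k pp pq p<q (s≤s z≤n) (s≤s z≤n) N≡ =
  connected , trans (½w+½s≡[w+s]/2 wiener S)
    (cong (_/ 2) (numerator (wiener + S) (a * b) (a + b) (a * a + b * b) W+S-identity))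
  where
  open EssentialIdealGraph p q a′ b′ k pp pq (<⇒≢ p<q) N≡
  open GraphTheory G using (wiener; pairSum)
  open ExponentBox a′ b′ using (a; b)
  S : ℕ
  S = pairSum (λ d → d * d)
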